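{- For every fixed $d\geq 2$ there is a constant $C_d$ such that every $N\times N$ sign matrix of VC dimension $d$ has sign rank at most $C_d N^{1-1/d}$; that is, $f(N,d)\leq O(N^{1-1/d})$, where $f(N,d)$ is the maximum sign rank of an $N\times N$ sign matrix with VC dimension $d$.
   Context: A sign matrix has entries in $\{\pm1\}$. Its sign rank is $\min\{\text{rank}(M): \text{sign}(M)=S\}$ over real matrices $M$ with no zero entries, $\text{sign}$ entrywise, rank over $\mathbb R$. A set $C$ of columns is shattered if every pattern in $\{\pm1\}^C$ appears as a row of the restriction of $S$ to $C$; the VC dimension is the maximum size of a shattered set of columns. -}

module Defs where

open import Data.Nat using (ℕ; _≤_)
open import Data.Fin using (Fin)
open import Data.Fin.Subset using (Subset; _∈_; ∣_∣)
open import Data.Rational using (ℚ; 0ℚ; _+_; _*_; _<_)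
open import Data.Vec.Functional using (foldr)
open import Data.Product using (Σ; ∃; _×_)
open import Relation.Binary.PropositionalEquality using (_≡_)

data Sign : Set where
  plus minus : Sign

SignMatrix : ℕ → ℕ → Set
SignMatrix m n = Fin m → Fin n → Sign

Matrix : ℕ → ℕ → Set
Matrix m n = Fin m → Fin n → ℚ

-- Entrywise sign of a matrix with no zero entries equals S
-- (strict inequalities force every entry to be nonzero).
HasSign : ∀ {m n} → Matrix m n → SignMatrix m n → Set
HasSign {m} {n} M S = (i : Fin m) (j : Fin n) → SignOf (S i j) (M i j)
  where
  SignOf : Sign → ℚ → Set
  SignOf plus  q = 0ℚ < q
  SignOf minus q = q < 0ℚ

dot : ∀ {r} → (Fin r → ℚ) → (Fin r → ℚ) → ℚ
dot {r} u v = foldr _+_ 0ℚ {r} (λ k → u k * v k)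

RankAtMost : ∀ {m n} → Matrix m n → ℕ → Set
RankAtMost {m} {n} M r =
  Σ (Fin m → Fin r → ℚ) λ U → Σ (Fin n → Fin r → ℚ) λ V →
    (i : Fin m) (j : Fin n) → M i j ≡ dot (U i) (V j)

SignRankAtMost : ∀ {m n} → SignMatrix m n → ℕ → Set
SignRankAtMost {m} {n} S r =
  Σ (Matrix m n) λ M → HasSign M S × RankAtMost M r

Shattered : ∀ {m n} → SignMatrix m n → Subset n → Set
Shattered {m} {n} S C =
  (p : Fin n → Sign) → Σ (Fin m) λ i → (j : Fin n) → j ∈ C → S i j ≡ p j

VCdimIs : ∀ {m n} → SignMatrix m n → ℕ → Set
VCdimIs {m} {n} S d =
  (Σ (Subset n) λ C → Shattered S C × ∣ C ∣ ≡ d)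
  × ((C : Subset n) → Shattered S C → ∣ C ∣ ≤ d)

{-# OPTIONS --safe #-}

-- If the rows of a sign matrix can be listed along a path that changes sign at most K times in
-- every column, its sign rank is at most K + 1: each column becomes a polynomial of degree ≤ K
-- with a root between any two consecutive rows of opposite signs, evaluated at twice the
-- positions of the rows. Such a path comes from Welzl's reweighting method. Haussler's packing
-- lemma (his edge bound for one-inclusion graphs, averaged over random column samples) gives,
-- among any n rows, two at weighted distance O(d W / n^(1/d)), column j having weight 2^(κ j).
-- One of them is put next to the other and κ j is increased on every column separating them, so
-- the total weight grows by at most a factor 2^O(N^(1-1/d)); as column j is crossed at most 2 κ j
-- times, every crossing number, and hence the sign rank, is O(N^(1-1/d)).
module Submission where

open import Defs

module Crossings where

  open import Data.Nat using (ℕ; _+_)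
  open import Data.Fin using (Fin)
  open import Data.List using (List; []; _∷_)

  disagree : Sign → Sign → ℕ
  disagree plus  plus  = 0
  disagree minus minus = 0
  disagree plus  minus = 1
  disagree minus plus  = 1

  crossings : ∀ {m n} → SignMatrix m n → Fin n → List (Fin m) → ℕ
  crossings S j []          = 0
  crossings S j (a ∷ [])    = 0
  crossings S j (a ∷ b ∷ l) = disagree (S a j) (S b j) + crossings S j (b ∷ l)

open Crossings

module SignRepresentation where

  open import Data.Nat as ℕ using (ℕ; zero; suc; z≤n; s≤s)
  import Data.Nat.Properties as ℕ
  import Data.Integer as ℤ
  import Data.Integer.Properties as ℤ
  open import Data.Rational
    using (ℚ; 0ℚ; 1ℚ; _+_; _*_; _-_; -_; _<_; *<*; positive; negative)
  open import Data.Rational.Properties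
  open import Data.Rational.Literals using (fromℤ)
  open import Data.Rational.Solver using (module +-*-Solver)
  open +-*-Solver using (solve; _:=_; _:+_; _:*_; _:-_; :-_; con)
  open import Data.Fin using (Fin; zero; suc)
  open import Data.List using (List; []; _∷_; length)
  open import Data.List.Relation.Unary.Any using (here; there)
  open import Data.List.Membership.Propositional using (_∈_)
  open import Data.Product using (_,_)
  open import Relation.Binary.PropositionalEquality
  open ≡-Reasoning

  ⟦_⟧ : ℕ → ℚ
  ⟦ n ⟧ = fromℤ (ℤ.+ n)

  ⟦⟧-mono-< : ∀ {m n} → m ℕ.< n → ⟦ m ⟧ < ⟦ n ⟧
  ⟦⟧-mono-< {m} {n} m<n =
    *<* (subst₂ ℤ._<_ (sym (ℤ.*-identityʳ (ℤ.+ m))) (sym (ℤ.*-identityʳ (ℤ.+ n))) (ℤ.+<+ m<n))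

  p<q⇒0<q-p : ∀ {p q} → p < q → 0ℚ < q - p
  p<q⇒0<q-p {p} {q} p<q = subst (_< q - p) (+-inverseʳ p) (+-monoˡ-< (- p) p<q)

  p<q⇒p-q<0 : ∀ {p q} → p < q → p - q < 0ℚ
  p<q⇒p-q<0 {p} {q} p<q = subst (p - q <_) (+-inverseʳ q) (+-monoˡ-< (- q) p<q)

  SignOf : Sign → ℚ → Set
  SignOf plus  q = 0ℚ < q
  SignOf minus q = q < 0ℚ

  opposite : Sign → Sign
  opposite plus  = minus
  opposite minus = plus

  SignOf-*-pos : ∀ {f p} s → 0ℚ < f → SignOf s p → SignOf s (f * p)
  SignOf-*-pos {f} {p} plus  0<f 0<p =
    positive⁻¹ (f * p) {{pos*pos⇒pos f {{positive 0<f}} p {{positive 0<p}}}}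
  SignOf-*-pos {f} {p} minus 0<f p<0 =
    negative⁻¹ (f * p) {{pos*neg⇒neg f {{positive 0<f}} p {{negative p<0}}}}

  SignOf-*-neg : ∀ {f p} s → f < 0ℚ → SignOf s p → SignOf (opposite s) (f * p)
  SignOf-*-neg {f} {p} plus  f<0 0<p =
    negative⁻¹ (f * p) {{neg*pos⇒neg f {{negative f<0}} p {{positive 0<p}}}}
  SignOf-*-neg {f} {p} minus f<0 p<0 =
    positive⁻¹ (f * p) {{neg*neg⇒pos f {{negative f<0}} p {{negative p<0}}}}

  -- Polynomials are coefficient lists, constant term first.
  eval : List ℚ → ℚ → ℚ
  eval []       t = 0ℚ
  eval (c ∷ cs) t = c + t * eval cs t

  eval-constant : ∀ c t → eval (c ∷ []) t ≡ c
  eval-constant c t = trans (cong (c +_) (*-zeroʳ t)) (+-identityʳ c)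

  subtractConst : ℚ → List ℚ → List ℚ
  subtractConst c []       = - c ∷ []
  subtractConst c (r ∷ rs) = r - c ∷ rs

  -- The coefficients of (α - X) p.
  mulRoot : ℚ → List ℚ → List ℚ
  mulRoot α []       = []
  mulRoot α (c ∷ cs) = α * c ∷ subtractConst c (mulRoot α cs)

  eval-subtractConst : ∀ c p t → eval (subtractConst c p) t ≡ eval p t - c
  eval-subtractConst c []       t =
    solve 2 (λ c t → (:- c) :+ t :* con 0ℚ := con 0ℚ :- c) refl c t
  eval-subtractConst c (r ∷ rs) t =
    solve 4 (λ c r t e → (r :- c) :+ t :* e := (r :+ t :* e) :- c) refl c r t (eval rs t)

  eval-mulRoot : ∀ α p t → eval (mulRoot α p) t ≡ (α - t) * eval p t
  eval-mulRoot α []       t = sym (*-zeroʳ (α - t))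
  eval-mulRoot α (c ∷ cs) t = begin
    α * c + t * eval (subtractConst c (mulRoot α cs)) t
      ≡⟨ cong (λ z → α * c + t * z) (eval-subtractConst c (mulRoot α cs) t) ⟩
    α * c + t * (eval (mulRoot α cs) t - c)
      ≡⟨ cong (λ z → α * c + t * (z - c)) (eval-mulRoot α cs t) ⟩
    α * c + t * ((α - t) * eval cs t - c)
      ≡⟨ solve 4 (λ α c t e → α :* c :+ t :* ((α :- t) :* e :- c) := (α :- t) :* (c :+ t :* e))
               refl α c t (eval cs t) ⟩
    (α - t) * (c + t * eval cs t) ∎

  length-mulRoot : ∀ α p → length (mulRoot α p) ℕ.≤ suc (length p)
  length-mulRoot α []           = z≤n
  length-mulRoot α (c ∷ [])     = s≤s (s≤s z≤n)
  length-mulRoot α (c ∷ c' ∷ cs) = s≤s (length-mulRoot α (c' ∷ cs))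

  signValue : Sign → ℚ
  signValue plus  = 1ℚ
  signValue minus = - 1ℚ

  SignOf-signValue : ∀ s → SignOf s (signValue s)
  SignOf-signValue plus  = positive⁻¹ 1ℚ
  SignOf-signValue minus = negative⁻¹ (- 1ℚ)

  -- Extends a polynomial for the sign b at the sample points 0, 2, …, 2m to one for the
  -- sign a at 2m + 2, by a root at 2m + 1 exactly when the sign changes.
  extend : Sign → Sign → ℕ → List ℚ → List ℚ
  extend plus  plus  m p = p
  extend minus minus m p = p
  extend plus  minus m p = mulRoot ⟦ suc (2 ℕ.* m) ⟧ p
  extend minus plus  m p = mulRoot ⟦ suc (2 ℕ.* m) ⟧ p

  SignOf-extend-below : ∀ a b m p t s → t < ⟦ suc (2 ℕ.* m) ⟧ →
    SignOf s (eval p t) → SignOf s (eval (extend a b m p) t)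
  SignOf-extend-below plus  plus  m p t s t<α sg = sg
  SignOf-extend-below minus minus m p t s t<α sg = sg
  SignOf-extend-below plus  minus m p t s t<α sg =
    subst (SignOf s) (sym (eval-mulRoot _ p t)) (SignOf-*-pos s (p<q⇒0<q-p t<α) sg)
  SignOf-extend-below minus plus  m p t s t<α sg =
    subst (SignOf s) (sym (eval-mulRoot _ p t)) (SignOf-*-pos s (p<q⇒0<q-p t<α) sg)

  SignOf-extend-above : ∀ a b m p t → ⟦ suc (2 ℕ.* m) ⟧ < t →
    SignOf b (eval p t) → SignOf a (eval (extend a b m p) t)
  SignOf-extend-above plus  plus  m p t α<t sg = sg
  SignOf-extend-above minus minus m p t α<t sg = sg
  SignOf-extend-above plus  minus m p t α<t sg =
    subst (SignOf plus) (sym (eval-mulRoot _ p t)) (SignOf-*-neg minus (p<q⇒p-q<0 α<t) sg)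
  SignOf-extend-above minus plus  m p t α<t sg =
    subst (SignOf minus) (sym (eval-mulRoot _ p t)) (SignOf-*-neg plus (p<q⇒p-q<0 α<t) sg)

  length-extend : ∀ a b m p → length (extend a b m p) ℕ.≤ disagree a b ℕ.+ length p
  length-extend plus  plus  m p = ℕ.≤-refl
  length-extend minus minus m p = ℕ.≤-refl
  length-extend plus  minus m p = length-mulRoot _ p
  length-extend minus plus  m p = length-mulRoot _ p

  coefficient : ∀ {k} → List ℚ → Fin k → ℚ
  coefficient []       _       = 0ℚ
  coefficient (c ∷ cs) zero    = c
  coefficient (c ∷ cs) (suc e) = coefficient cs e

  powers : ∀ {k} → ℚ → Fin k → ℚ
  powers t zero    = 1ℚ
  powers t (suc e) = t * powers t e

  dot-zeroʳ : ∀ k (u : Fin k → ℚ) → dot u (λ _ → 0ℚ) ≡ 0ℚ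
  dot-zeroʳ zero    u = refl
  dot-zeroʳ (suc k) u = trans (cong₂ _+_ (*-zeroʳ (u zero)) (dot-zeroʳ k (λ e → u (suc e))))
                              (+-identityʳ 0ℚ)

  dot-scaleˡ : ∀ k t (u v : Fin k → ℚ) → dot (λ e → t * u e) v ≡ t * dot u v
  dot-scaleˡ zero    t u v = sym (*-zeroʳ t)
  dot-scaleˡ (suc k) t u v = begin
    t * u zero * v zero + dot (λ e → t * u (suc e)) (λ e → v (suc e))
      ≡⟨ cong (t * u zero * v zero +_) (dot-scaleˡ k t (λ e → u (suc e)) (λ e → v (suc e))) ⟩
    t * u zero * v zero + t * dot (λ e → u (suc e)) (λ e → v (suc e))
      ≡⟨ solve 4 (λ t a b r → t :* a :* b :+ t :* r := t :* (a :* b :+ r)) refl t (u zero) (v zero) _ ⟩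
    t * (u zero * v zero + dot (λ e → u (suc e)) (λ e → v (suc e))) ∎

  dot-powers-coefficient : ∀ k t p → length p ℕ.≤ k → dot {k} (powers t) (coefficient p) ≡ eval p t
  dot-powers-coefficient zero    t []       _         = refl
  dot-powers-coefficient (suc k) t []       _         = dot-zeroʳ (suc k) (powers t)
  dot-powers-coefficient (suc k) t (c ∷ cs) (s≤s p≤k) = cong₂ _+_ (*-identityˡ c)
    (trans (dot-scaleˡ k t (powers t) (coefficient cs)) (cong (t *_) (dot-powers-coefficient k t cs p≤k)))

  module _ {m n : ℕ} (S : SignMatrix m n) where

    -- The head of a path a ∷ l sits at position length l; rows are sampled at twice their position.
    position : ∀ {r} {l : List (Fin m)} → r ∈ l → ℕ
    position {l = _ ∷ l} (here _) = length l
    position (there r∈l)          = position r∈l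

    position< : ∀ {r} {l : List (Fin m)} (r∈l : r ∈ l) → position r∈l ℕ.< length l
    position< (here _)     = ℕ.≤-refl
    position< (there r∈l) = ℕ.m≤n⇒m≤1+n (position< r∈l)

    pathPoly : Fin n → List (Fin m) → List ℚ
    pathPoly j []          = []
    pathPoly j (a ∷ [])    = signValue (S a j) ∷ []
    pathPoly j (a ∷ b ∷ l) = extend (S a j) (S b j) (length l) (pathPoly j (b ∷ l))

    SignOf-pathPoly-beyond : ∀ j a l x → length l ℕ.≤ x →
      SignOf (S a j) (eval (pathPoly j (a ∷ l)) ⟦ 2 ℕ.* x ⟧)
    SignOf-pathPoly-beyond j a []      x l≤x =
      subst (SignOf (S a j)) (sym (eval-constant (signValue (S a j)) ⟦ 2 ℕ.* x ⟧)) (SignOf-signValue (S a j))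
    SignOf-pathPoly-beyond j a (b ∷ l) x l<x =
      SignOf-extend-above (S a j) (S b j) (length l) (pathPoly j (b ∷ l)) _
        (⟦⟧-mono-< (subst (ℕ._≤ 2 ℕ.* x) (ℕ.*-suc 2 (length l)) (ℕ.*-monoʳ-≤ 2 l<x)))
        (SignOf-pathPoly-beyond j b l x (ℕ.<⇒≤ l<x))

    SignOf-pathPoly : ∀ j {r} l (r∈l : r ∈ l) →
      SignOf (S r j) (eval (pathPoly j l) ⟦ 2 ℕ.* position r∈l ⟧)
    SignOf-pathPoly j (a ∷ l)     (here refl)  = SignOf-pathPoly-beyond j a l (length l) ℕ.≤-refl
    SignOf-pathPoly j (a ∷ b ∷ l) (there r∈l) =
      SignOf-extend-below (S a j) (S b j) (length l) (pathPoly j (b ∷ l)) _ _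
        (⟦⟧-mono-< (s≤s (ℕ.*-monoʳ-≤ 2 (ℕ.≤-pred (position< r∈l)))))
        (SignOf-pathPoly j (b ∷ l) r∈l)

    length-pathPoly : ∀ j l → length (pathPoly j l) ℕ.≤ suc (crossings S j l)
    length-pathPoly j []          = z≤n
    length-pathPoly j (a ∷ [])    = s≤s z≤n
    length-pathPoly j (a ∷ b ∷ l) = ℕ.≤-trans (length-extend (S a j) (S b j) _ _)
      (ℕ.≤-trans (ℕ.+-monoʳ-≤ (disagree (S a j) (S b j)) (length-pathPoly j (b ∷ l)))
                 (ℕ.≤-reflexive (ℕ.+-suc _ _)))

    signRank≤1+crossings : ∀ K (L : List (Fin m)) →
      (∀ i → i ∈ L) → (∀ j → crossings S j L ℕ.≤ K) →
      SignRankAtMost S (suc K)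
    signRank≤1+crossings K L i∈L crossings≤K = M , M-hasSign , U , V , λ i j → refl
      where
      U : Fin m → Fin (suc K) → ℚ
      U i = powers ⟦ 2 ℕ.* position (i∈L i) ⟧
      V : Fin n → Fin (suc K) → ℚ
      V j = coefficient (pathPoly j L)
      M : Matrix m n
      M i j = dot (U i) (V j)
      SignOf-M : ∀ i j → SignOf (S i j) (M i j)
      SignOf-M i j = subst (SignOf (S i j))
        (sym (dot-powers-coefficient (suc K) _ (pathPoly j L)
               (ℕ.≤-trans (length-pathPoly j L) (s≤s (crossings≤K j)))))
        (SignOf-pathPoly j L (i∈L i))
      M-hasSign : HasSign M S
      M-hasSign i j with S i j | SignOf-M i j
      ... | plus  | sg = sg
      ... | minus | sg = sg

open SignRepresentation using (signRank≤1+crossings)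

open import Data.Nat
open import Data.Nat.Properties
open import Data.Nat.Tactic.RingSolver using (solve-∀)
open import Algebra.Properties.Semiring.Sum +-*-semiring
  using (sum; sum-syntax; ∑-distrib-+; ∑-comm; *-distribˡ-sum; *-distribʳ-sum; sum-cong-≗; sum-remove)
open import Data.Fin using (Fin; zero; suc; punchIn; punchOut)
import Data.Fin.Properties as Fin
import Data.Fin.Subset as Subset
open Subset using (Subset; inside; outside; ⊥; ∣_∣)
open import Data.Fin.Subset.Properties using (∉⊥)
open import Data.Vec using (Vec; []; _∷_; insertAt; map; replicate; here; there; _[_]≔_)
open import Data.Vec.Properties using (map-insertAt)
open import Data.List using (List; []; _∷_)
open import Data.List.Relation.Unary.Any using (here; there)
open import Data.List.Membership.Propositional using (_∈_)
open import Data.Product using (Σ; ∃; _×_; _,_; proj₁; proj₂)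
open import Data.Sum using (_⊎_; inj₁; inj₂)
open import Data.Unit using (⊤; tt)
open import Data.Empty using (⊥-elim)
open import Function using (_∘_; id)
open import Relation.Binary.PropositionalEquality
open import Relation.Nullary using (yes; no; contradiction)
open import Relation.Nullary.Decidable using (¬?; _×-dec_)

sum-mono-≤ : ∀ {n} {f g : Fin n → ℕ} → (∀ i → f i ≤ g i) → sum f ≤ sum g
sum-mono-≤ {zero}  f≤g = z≤n
sum-mono-≤ {suc n} f≤g = +-mono-≤ (f≤g zero) (sum-mono-≤ (f≤g ∘ suc))

sum-const : ∀ n c → ∑[ i < n ] c ≡ n * c
sum-const zero    c = refl
sum-const (suc n) c = cong (c +_) (sum-const n c)

f≤sum : ∀ {n} (f : Fin n → ℕ) i → f i ≤ sum f
f≤sum f zero    = m≤m+n (f zero) _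
f≤sum f (suc i) = ≤-trans (f≤sum (f ∘ suc) i) (m≤n+m _ (f zero))

sum-pos : ∀ {n} (f : Fin n → ℕ) → 0 < sum f → ∃ λ i → 0 < f i
sum-pos {suc n} f 0<∑ with f zero in eq
... | suc _ = zero , subst (0 <_) (sym eq) z<s
... | zero  = let i , 0<fi = sum-pos (f ∘ suc) 0<∑ in suc i , 0<fi

∑∑-product : ∀ {k l} (f : Fin k → ℕ) (h : Fin l → ℕ) →
  ∑[ a < k ] ∑[ b < l ] (f a * h b) ≡ sum f * sum h
∑∑-product {k} {l} f h = begin
  ∑[ a < k ] ∑[ b < l ] (f a * h b)  ≡⟨ sum-cong-≗ {k} (λ a → *-distribˡ-sum {l} (f a) h) ⟨
  ∑[ a < k ] (f a * sum h)           ≡⟨ *-distribʳ-sum {k} (sum h) f ⟨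
  sum f * sum h                    ∎
  where open ≡-Reasoning

∑ᵛ : ∀ {A : Set} {k} → (Fin k → A) → ∀ m → (Vec A m → ℕ) → ℕ
∑ᵛ           enum zero    f = f []
∑ᵛ {k = k} enum (suc m) f = ∑[ x < k ] ∑ᵛ enum m (λ v → f (enum x ∷ v))

module _ {A : Set} {k : ℕ} {enum : Fin k → A} where

  ∑ᵛ-cong : ∀ m {f g : Vec A m → ℕ} → (∀ v → f v ≡ g v) → ∑ᵛ enum m f ≡ ∑ᵛ enum m g
  ∑ᵛ-cong zero    f≗g = f≗g []
  ∑ᵛ-cong (suc m) f≗g = sum-cong-≗ {k} (λ x → ∑ᵛ-cong m (λ v → f≗g (enum x ∷ v)))

  ∑ᵛ-mono-≤ : ∀ m {f g : Vec A m → ℕ} → (∀ v → f v ≤ g v) → ∑ᵛ enum m f ≤ ∑ᵛ enum m g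
  ∑ᵛ-mono-≤ zero    f≤g = f≤g []
  ∑ᵛ-mono-≤ (suc m) f≤g = sum-mono-≤ (λ x → ∑ᵛ-mono-≤ m (λ v → f≤g (enum x ∷ v)))

  ∑ᵛ-distrib-+ : ∀ m (f g : Vec A m → ℕ) →
    ∑ᵛ enum m (λ v → f v + g v) ≡ ∑ᵛ enum m f + ∑ᵛ enum m g
  ∑ᵛ-distrib-+ zero    f g = refl
  ∑ᵛ-distrib-+ (suc m) f g = trans
    (sum-cong-≗ {k} (λ x → ∑ᵛ-distrib-+ m (λ v → f (enum x ∷ v)) (λ v → g (enum x ∷ v))))
    (∑-distrib-+ {k} _ _)

  *-distribˡ-∑ᵛ : ∀ m c (f : Vec A m → ℕ) → ∑ᵛ enum m (λ v → c * f v) ≡ c * ∑ᵛ enum m f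
  *-distribˡ-∑ᵛ zero    c f = refl
  *-distribˡ-∑ᵛ (suc m) c f = trans (sum-cong-≗ {k} (λ x → *-distribˡ-∑ᵛ m c (λ v → f (enum x ∷ v))))
                                    (sym (*-distribˡ-sum {k} c _))

  *-distribʳ-∑ᵛ : ∀ m c (f : Vec A m → ℕ) → ∑ᵛ enum m (λ v → f v * c) ≡ ∑ᵛ enum m f * c
  *-distribʳ-∑ᵛ m c f = trans (∑ᵛ-cong m (λ v → *-comm (f v) c))
                              (trans (*-distribˡ-∑ᵛ m c f) (*-comm c _))

  ∑ᵛ-comm : ∀ m {n} (f : Vec A m → Fin n → ℕ) →
    ∑ᵛ enum m (λ v → ∑[ i < n ] f v i) ≡ ∑[ i < n ] ∑ᵛ enum m (λ v → f v i)
  ∑ᵛ-comm zero    f = refl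
  ∑ᵛ-comm (suc m) {n} f =
    trans (sum-cong-≗ {k} (λ x → ∑ᵛ-comm m (λ v → f (enum x ∷ v)))) (∑-comm {k} {n} _)

  ∑ᵛ-insertAt : ∀ m (p : Fin (suc m)) (f : Vec A (suc m) → ℕ) →
    ∑ᵛ enum (suc m) f ≡ ∑ᵛ enum m (λ v → ∑[ x < k ] f (insertAt v p (enum x)))
  ∑ᵛ-insertAt m       zero    f = sym (∑ᵛ-comm m (λ v x → f (enum x ∷ v)))
  ∑ᵛ-insertAt (suc m) (suc p) f = sum-cong-≗ {k} (λ y → ∑ᵛ-insertAt m p (λ v → f (enum y ∷ v)))

  ∑ᵛ-zero : ∀ m (f : Vec A m → ℕ) → (∀ v → f v ≡ 0) → ∑ᵛ enum m f ≡ 0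
  ∑ᵛ-zero m f f≡0 = trans (∑ᵛ-cong m f≡0) (*-distribˡ-∑ᵛ m 0 (λ _ → 0))

-- Shattering on the cube: Sauer–Shelah and Haussler's edge bound

δ : Sign → Sign → ℕ
δ plus  plus  = 1
δ minus minus = 1
δ plus  minus = 0
δ minus plus  = 0

δᵛ : ∀ {m} → Vec Sign m → Vec Sign m → ℕ
δᵛ []          []          = 1
δᵛ (plus  ∷ u) (plus  ∷ v) = δᵛ u v
δᵛ (minus ∷ u) (minus ∷ v) = δᵛ u v
δᵛ (plus  ∷ u) (minus ∷ v) = 0
δᵛ (minus ∷ u) (plus  ∷ v) = 0

δᵛ-∷ : ∀ {m} a b (u v : Vec Sign m) → δᵛ (a ∷ u) (b ∷ v) ≡ δ a b * δᵛ u v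
δᵛ-∷ plus  plus  u v = sym (+-identityʳ _)
δᵛ-∷ minus minus u v = sym (+-identityʳ _)
δᵛ-∷ plus  minus u v = refl
δᵛ-∷ minus plus  u v = refl

δᵛ-insertAt : ∀ {m} (u v : Vec Sign m) p a b →
  δᵛ (insertAt u p a) (insertAt v p b) ≡ δ a b * δᵛ u v
δᵛ-insertAt u       v       zero    a b = δᵛ-∷ a b u v
δᵛ-insertAt (c ∷ u) (e ∷ v) (suc p) a b = begin
  δᵛ (c ∷ insertAt u p a) (e ∷ insertAt v p b)  ≡⟨ δᵛ-∷ c e _ _ ⟩
  δ c e * δᵛ (insertAt u p a) (insertAt v p b)  ≡⟨ cong (δ c e *_) (δᵛ-insertAt u v p a b) ⟩
  δ c e * (δ a b * δᵛ u v)                      ≡⟨ *-comm-middle (δ c e) (δ a b) (δᵛ u v) ⟩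
  δ a b * (δ c e * δᵛ u v)                      ≡⟨ cong (δ a b *_) (δᵛ-∷ c e u v) ⟨
  δ a b * δᵛ (c ∷ u) (e ∷ v)                    ∎
  where
  open ≡-Reasoning
  *-comm-middle : ∀ x y z → x * (y * z) ≡ y * (x * z)
  *-comm-middle = solve-∀

δᵛ-pos : ∀ {m} (u v : Vec Sign m) → 0 < δᵛ u v → u ≡ v
δᵛ-pos []          []          _   = refl
δᵛ-pos (plus  ∷ u) (plus  ∷ v) 0<δ = cong (plus ∷_) (δᵛ-pos u v 0<δ)
δᵛ-pos (minus ∷ u) (minus ∷ v) 0<δ = cong (minus ∷_) (δᵛ-pos u v 0<δ)

δᵛ≡0⊎δᵛ≡1 : ∀ {m} (u v : Vec Sign m) → δᵛ u v ≡ 0 ⊎ δᵛ u v ≡ 1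
δᵛ≡0⊎δᵛ≡1 []          []          = inj₂ refl
δᵛ≡0⊎δᵛ≡1 (plus  ∷ u) (plus  ∷ v) = δᵛ≡0⊎δᵛ≡1 u v
δᵛ≡0⊎δᵛ≡1 (minus ∷ u) (minus ∷ v) = δᵛ≡0⊎δᵛ≡1 u v
δᵛ≡0⊎δᵛ≡1 (plus  ∷ u) (minus ∷ v) = inj₁ refl
δᵛ≡0⊎δᵛ≡1 (minus ∷ u) (plus  ∷ v) = inj₁ refl

disagree-sym : ∀ s t → disagree s t ≡ disagree t s
disagree-sym plus  plus  = refl
disagree-sym plus  minus = refl
disagree-sym minus plus  = refl
disagree-sym minus minus = refl

disagree-triangle : ∀ s t u → disagree s u ≤ disagree s t + disagree t u
disagree-triangle plus  plus  u     = ≤-refl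
disagree-triangle minus minus u     = ≤-refl
disagree-triangle s     plus  plus  = m≤m+n _ 0
disagree-triangle s     minus minus = m≤m+n _ 0
disagree-triangle plus  minus plus  = z≤n
disagree-triangle minus plus  minus = z≤n

disagree≤1 : ∀ s t → disagree s t ≤ 1
disagree≤1 plus  plus  = z≤n
disagree≤1 plus  minus = ≤-refl
disagree≤1 minus plus  = ≤-refl
disagree≤1 minus minus = z≤n

disagree-δ : ∀ s t → disagree s t ≡ δ s plus * δ t minus + δ s minus * δ t plus
disagree-δ plus  plus  = refl
disagree-δ plus  minus = refl
disagree-δ minus plus  = refl
disagree-δ minus minus = refl

signAt : Fin 2 → Sign
signAt zero       = plus
signAt (suc zero) = minus

∑ᶜ : ∀ m → (Vec Sign m → ℕ) → ℕ
∑ᶜ = ∑ᵛ signAt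

∑ᶜ-split : ∀ m (f : Vec Sign (suc m) → ℕ) →
  ∑ᶜ (suc m) f ≡ ∑ᶜ m (λ u → f (plus ∷ u)) + ∑ᶜ m (λ u → f (minus ∷ u))
∑ᶜ-split m f = cong (∑ᶜ m (λ u → f (plus ∷ u)) +_) (+-identityʳ _)

∑ᶜ-δᵛ : ∀ m (u : Vec Sign m) → ∑ᶜ m (δᵛ u) ≡ 1
∑ᶜ-δᵛ zero    []          = refl
∑ᶜ-δᵛ (suc m) (plus  ∷ u) = begin
  ∑ᶜ (suc m) (δᵛ (plus ∷ u))                  ≡⟨ ∑ᶜ-split m (δᵛ (plus ∷ u)) ⟩
  ∑ᶜ m (δᵛ u) + ∑ᶜ m (λ _ → 0)                ≡⟨ cong₂ _+_ (∑ᶜ-δᵛ m u) (∑ᵛ-zero m _ (λ _ → refl)) ⟩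
  1                                           ∎
  where open ≡-Reasoning
∑ᶜ-δᵛ (suc m) (minus ∷ u) = begin
  ∑ᶜ (suc m) (δᵛ (minus ∷ u))                 ≡⟨ ∑ᶜ-split m (δᵛ (minus ∷ u)) ⟩
  ∑ᶜ m (λ _ → 0) + ∑ᶜ m (δᵛ u)                ≡⟨ cong₂ _+_ (∑ᵛ-zero m _ (λ _ → refl)) (∑ᶜ-δᵛ m u) ⟩
  1                                           ∎
  where open ≡-Reasoning

-- A weight w : Vec Sign m → ℕ is a multiset of sign patterns on m coordinates.
AgreeOn : ∀ {m} → Subset m → Vec Sign m → Vec Sign m → Set
AgreeOn []            []      []      = ⊤
AgreeOn (inside  ∷ T) (a ∷ u) (b ∷ v) = a ≡ b × AgreeOn T u v
AgreeOn (outside ∷ T) (a ∷ u) (b ∷ v) = AgreeOn T u v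

Shatters : ∀ {m} → (Vec Sign m → ℕ) → Subset m → Set
Shatters {m} w T = ∀ v → Σ (Vec Sign m) λ u → 0 < w u × AgreeOn T u v

VC≤ : ∀ {m} → ℕ → (Vec Sign m → ℕ) → Set
VC≤ d w = ∀ T → Shatters w T → ∣ T ∣ ≤ d

AgreeOn-⊥ : ∀ {m} (u v : Vec Sign m) → AgreeOn ⊥ u v
AgreeOn-⊥ []      []      = tt
AgreeOn-⊥ (a ∷ u) (b ∷ v) = AgreeOn-⊥ u v

0<m⊔n : ∀ m n → 0 < m ⊔ n → 0 < m ⊎ 0 < n
0<m⊔n zero    n 0<n = inj₂ 0<n
0<m⊔n (suc m) n _   = inj₁ z<s

0<m⊓n : ∀ m n → 0 < m ⊓ n → 0 < m × 0 < n
0<m⊓n (suc m) (suc n) _ = z<s , z<s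

m⊔n+m⊓n≡m+n : ∀ m n → m ⊔ n + m ⊓ n ≡ m + n
m⊔n+m⊓n≡m+n m n with ≤-total m n
... | inj₁ m≤n = trans (cong₂ _+_ (m≤n⇒m⊔n≡n m≤n) (m≤n⇒m⊓n≡m m≤n)) (+-comm n m)
... | inj₂ n≤m = cong₂ _+_ (m≥n⇒m⊔n≡m n≤m) (m≥n⇒m⊓n≡n n≤m)

module Halves {m : ℕ} (w : Vec Sign (suc m) → ℕ) where

  w⁺ w⁻ w⊔ w⊓ : Vec Sign m → ℕ
  w⁺ u = w (plus ∷ u)
  w⁻ u = w (minus ∷ u)
  w⊔ u = w⁺ u ⊔ w⁻ u
  w⊓ u = w⁺ u ⊓ w⁻ u

  ∑ᶜ-halves : ∑ᶜ (suc m) w ≡ ∑ᶜ m w⊔ + ∑ᶜ m w⊓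
  ∑ᶜ-halves = begin
    ∑ᶜ (suc m) w                   ≡⟨ ∑ᶜ-split m w ⟩
    ∑ᶜ m w⁺ + ∑ᶜ m w⁻              ≡⟨ ∑ᵛ-distrib-+ m w⁺ w⁻ ⟨
    ∑ᶜ m (λ u → w⁺ u + w⁻ u)       ≡⟨ ∑ᵛ-cong m (λ u → m⊔n+m⊓n≡m+n (w⁺ u) (w⁻ u)) ⟨
    ∑ᶜ m (λ u → w⊔ u + w⊓ u)       ≡⟨ ∑ᵛ-distrib-+ m w⊔ w⊓ ⟩
    ∑ᶜ m w⊔ + ∑ᶜ m w⊓              ∎
    where open ≡-Reasoning

  Shatters-w⊔ : ∀ T → Shatters w⊔ T → Shatters w (outside ∷ T)
  Shatters-w⊔ T sh (_ ∷ v) with sh v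
  ... | u , 0<w⊔u , agree with 0<m⊔n (w⁺ u) (w⁻ u) 0<w⊔u
  ... | inj₁ 0<w⁺u = plus ∷ u , 0<w⁺u , agree
  ... | inj₂ 0<w⁻u = minus ∷ u , 0<w⁻u , agree

  Shatters-w⊓ : ∀ T → Shatters w⊓ T → Shatters w (inside ∷ T)
  Shatters-w⊓ T sh (plus ∷ v) with sh v
  ... | u , 0<w⊓u , agree = plus ∷ u , proj₁ (0<m⊓n (w⁺ u) (w⁻ u) 0<w⊓u) , refl , agree
  Shatters-w⊓ T sh (minus ∷ v) with sh v
  ... | u , 0<w⊓u , agree = minus ∷ u , proj₂ (0<m⊓n (w⁺ u) (w⁻ u) 0<w⊓u) , refl , agree

  VC≤-w⊔ : ∀ {d} → VC≤ d w → VC≤ d w⊔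
  VC≤-w⊔ vc T sh = vc (outside ∷ T) (Shatters-w⊔ T sh)

  VC≤-w⊓ : ∀ {d} → VC≤ (suc d) w → VC≤ d w⊓
  VC≤-w⊓ vc T sh = ≤-pred (vc (inside ∷ T) (Shatters-w⊓ T sh))

  VC≤0⇒w⊓≡0 : VC≤ 0 w → ∀ u → w⊓ u ≡ 0
  VC≤0⇒w⊓≡0 vc u with w⊓ u in eq
  ... | zero  = refl
  ... | suc _ with vc (inside ∷ ⊥)
                  (Shatters-w⊓ _ (λ v → u , subst (0 <_) (sym eq) z<s , AgreeOn-⊥ u v))
  ... | ()

VC≤-0 : ∀ {m d} (w : Vec Sign m → ℕ) → (∀ u → w u ≡ 0) → VC≤ d w
VC≤-0 {m} w w≡0 T sh with sh (replicate m plus)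
... | u , 0<wu , _ = ⊥-elim (<-irrefl (sym (w≡0 u)) 0<wu)

indicator : ℕ → ℕ
indicator zero    = 0
indicator (suc _) = 1

indicator-⊔-⊓ : ∀ m n → indicator m + indicator n ≡ indicator (m ⊔ n) + indicator (m ⊓ n)
indicator-⊔-⊓ zero    zero    = refl
indicator-⊔-⊓ zero    (suc n) = refl
indicator-⊔-⊓ (suc m) zero    = refl
indicator-⊔-⊓ (suc m) (suc n) = refl

support : ∀ {m} → (Vec Sign m → ℕ) → ℕ
support {m} w = ∑ᶜ m (indicator ∘ w)

support-halves : ∀ {m} (w : Vec Sign (suc m) → ℕ) → let open Halves w in
  support w ≡ support w⊔ + support w⊓
support-halves {m} w = begin
  support w                                             ≡⟨ ∑ᶜ-split m (indicator ∘ w) ⟩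
  support w⁺ + support w⁻                               ≡⟨ ∑ᵛ-distrib-+ m _ _ ⟨
  ∑ᶜ m (λ u → indicator (w⁺ u) + indicator (w⁻ u))      ≡⟨ ∑ᵛ-cong m (λ u → indicator-⊔-⊓ (w⁺ u) (w⁻ u)) ⟩
  ∑ᶜ m (λ u → indicator (w⊔ u) + indicator (w⊓ u))      ≡⟨ ∑ᵛ-distrib-+ m _ _ ⟩
  support w⊔ + support w⊓                               ∎
  where open Halves w
        open ≡-Reasoning

[1+m]^[1+d]+[1+m]^d≤[2+m]^[1+d] : ∀ m d → suc m ^ suc d + suc m ^ d ≤ suc (suc m) ^ suc d
[1+m]^[1+d]+[1+m]^d≤[2+m]^[1+d] m d = begin
  suc m * suc m ^ d + suc m ^ d  ≡⟨ +-comm (suc m * suc m ^ d) _ ⟩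
  suc (suc m) * suc m ^ d        ≤⟨ *-monoʳ-≤ (suc (suc m)) (^-monoˡ-≤ d (n≤1+n (suc m))) ⟩
  suc (suc m) * suc (suc m) ^ d  ∎
  where open ≤-Reasoning

sauer-shelah : ∀ {m d} (w : Vec Sign m → ℕ) → VC≤ d w → support w ≤ suc m ^ d
sauer-shelah {zero}  {d} w vc = ≤-trans (indicator≤1 (w [])) (≤-reflexive (sym (^-zeroˡ d)))
  where
  indicator≤1 : ∀ n → indicator n ≤ 1
  indicator≤1 zero    = z≤n
  indicator≤1 (suc n) = s≤s z≤n
sauer-shelah {suc m} {d} w vc = begin
  support w                ≡⟨ support-halves w ⟩
  support w⊔ + support w⊓  ≤⟨ bound d vc ⟩
  suc (suc m) ^ d          ∎
  where
  open Halves w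
  open ≤-Reasoning
  bound : ∀ d → VC≤ d w → support w⊔ + support w⊓ ≤ suc (suc m) ^ d
  bound zero    vc = begin
    support w⊔ + support w⊓  ≡⟨ cong (support w⊔ +_) (∑ᵛ-zero m _ (cong indicator ∘ VC≤0⇒w⊓≡0 vc)) ⟩
    support w⊔ + 0           ≡⟨ +-identityʳ _ ⟩
    support w⊔               ≤⟨ sauer-shelah w⊔ (VC≤-w⊔ vc) ⟩
    1                        ∎
  bound (suc d) vc = ≤-trans (+-mono-≤ (sauer-shelah w⊔ (VC≤-w⊔ vc)) (sauer-shelah w⊓ (VC≤-w⊓ vc)))
                             ([1+m]^[1+d]+[1+m]^d≤[2+m]^[1+d] m d)

-- Weighted edges of the one-inclusion graph in direction p.
edges : ∀ {m} → Fin m → (Vec Sign m → ℕ) → ℕ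
edges {suc m} p w = ∑ᶜ m (λ u → w (insertAt u p plus) ⊓ w (insertAt u p minus))

edgeCount : ∀ m → (Vec Sign m → ℕ) → ℕ
edgeCount m w = ∑[ p < m ] edges p w

edges-suc : ∀ {m} (w : Vec Sign (suc m) → ℕ) (p : Fin m) → let open Halves w in
  edges (suc p) w ≡ edges p w⁺ + edges p w⁻
edges-suc {suc m} w p = ∑ᶜ-split m (λ u → w (insertAt u (suc p) plus) ⊓ w (insertAt u (suc p) minus))

edgeCount-halves : ∀ {m} (w : Vec Sign (suc m) → ℕ) → let open Halves w in
  edgeCount (suc m) w ≡ ∑ᶜ m w⊓ + (edgeCount m w⁺ + edgeCount m w⁻)
edgeCount-halves {m} w =
  cong (∑ᶜ m w⊓ +_) (trans (sum-cong-≗ {m} (edges-suc w)) (∑-distrib-+ {m} _ _))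
  where open Halves w

⊓-supermodular : ∀ a₁ a₂ b₁ b₂ →
  a₁ ⊓ a₂ + b₁ ⊓ b₂ ≤ (a₁ ⊔ b₁) ⊓ (a₂ ⊔ b₂) + (a₁ ⊓ b₁) ⊓ (a₂ ⊓ b₂)
⊓-supermodular zero       a₂         b₁         b₂         =
  ≤-trans (⊓-monoʳ-≤ b₁ (m≤n⊔m a₂ b₂)) (m≤m+n _ 0)
⊓-supermodular (suc a₁)   zero       b₁         b₂         =
  ≤-trans (⊓-monoˡ-≤ b₂ (m≤n⊔m (suc a₁) b₁)) (m≤m+n _ _)
⊓-supermodular (suc a₁)   (suc a₂)   zero       b₂         =
  +-monoˡ-≤ 0 (⊓-monoʳ-≤ (suc a₁) (m≤m⊔n (suc a₂) b₂))
⊓-supermodular (suc a₁)   (suc a₂)   (suc b₁)   zero       =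
  +-monoˡ-≤ 0 (s≤s (⊓-monoˡ-≤ a₂ (m≤m⊔n a₁ b₁)))
⊓-supermodular (suc a₁)   (suc a₂)   (suc b₁)   (suc b₂)   =
  s≤s (subst₂ _≤_ (sym (+-suc _ _)) (sym (+-suc _ _)) (s≤s (⊓-supermodular a₁ a₂ b₁ b₂)))

edges-supermodular : ∀ {m} (p : Fin m) (a b : Vec Sign m → ℕ) →
  edges p a + edges p b ≤ edges p (λ u → a u ⊔ b u) + edges p (λ u → a u ⊓ b u)
edges-supermodular {suc m} p a b = begin
  edges p a + edges p b
    ≡⟨ ∑ᵛ-distrib-+ m _ _ ⟨
  ∑ᶜ m (λ u → a (u ⟨ plus ⟩) ⊓ a (u ⟨ minus ⟩) + b (u ⟨ plus ⟩) ⊓ b (u ⟨ minus ⟩))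
    ≤⟨ ∑ᵛ-mono-≤ m (λ u →
         ⊓-supermodular (a (u ⟨ plus ⟩)) (a (u ⟨ minus ⟩)) (b (u ⟨ plus ⟩)) (b (u ⟨ minus ⟩))) ⟩
  ∑ᶜ m (λ u → (a (u ⟨ plus ⟩) ⊔ b (u ⟨ plus ⟩)) ⊓ (a (u ⟨ minus ⟩) ⊔ b (u ⟨ minus ⟩))
            + (a (u ⟨ plus ⟩) ⊓ b (u ⟨ plus ⟩)) ⊓ (a (u ⟨ minus ⟩) ⊓ b (u ⟨ minus ⟩)))
    ≡⟨ ∑ᵛ-distrib-+ m _ _ ⟩
  edges p (λ u → a u ⊔ b u) + edges p (λ u → a u ⊓ b u) ∎
  where
  open ≤-Reasoning
  _⟨_⟩ : Vec Sign m → Sign → Vec Sign (suc m)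
  u ⟨ s ⟩ = insertAt u p s

edgeCount-supermodular : ∀ m (a b : Vec Sign m → ℕ) →
  edgeCount m a + edgeCount m b ≤ edgeCount m (λ u → a u ⊔ b u) + edgeCount m (λ u → a u ⊓ b u)
edgeCount-supermodular m a b = begin
  edgeCount m a + edgeCount m b
    ≡⟨ ∑-distrib-+ {m} _ _ ⟨
  ∑[ p < m ] (edges p a + edges p b)
    ≤⟨ sum-mono-≤ (λ p → edges-supermodular p a b) ⟩
  ∑[ p < m ] (edges p (λ u → a u ⊔ b u) + edges p (λ u → a u ⊓ b u))
    ≡⟨ ∑-distrib-+ {m} _ _ ⟩
  edgeCount m (λ u → a u ⊔ b u) + edgeCount m (λ u → a u ⊓ b u) ∎
  where open ≤-Reasoning

edgeCount≤ : ∀ {m d} (w : Vec Sign m → ℕ) → VC≤ d w → edgeCount m w ≤ d * ∑ᶜ m w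
edgeCount≤ {zero}  w vc = z≤n
edgeCount≤ {suc m} {d} w vc = begin
  edgeCount (suc m) w
    ≡⟨ edgeCount-halves w ⟩
  ∑ᶜ m w⊓ + (edgeCount m w⁺ + edgeCount m w⁻)
    ≤⟨ +-monoʳ-≤ (∑ᶜ m w⊓) (edgeCount-supermodular m w⁺ w⁻) ⟩
  ∑ᶜ m w⊓ + (edgeCount m w⊔ + edgeCount m w⊓)
    ≤⟨ bound d vc ⟩
  d * (∑ᶜ m w⊔ + ∑ᶜ m w⊓)
    ≡⟨ cong (d *_) ∑ᶜ-halves ⟨
  d * ∑ᶜ (suc m) w ∎
  where
  open Halves w
  open ≤-Reasoning
  bound : ∀ d → VC≤ d w → ∑ᶜ m w⊓ + (edgeCount m w⊔ + edgeCount m w⊓) ≤ d * (∑ᶜ m w⊔ + ∑ᶜ m w⊓)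
  bound zero    vc = begin
    ∑ᶜ m w⊓ + (edgeCount m w⊔ + edgeCount m w⊓)
      ≡⟨ cong (_+ (edgeCount m w⊔ + edgeCount m w⊓)) (∑ᵛ-zero m w⊓ (VC≤0⇒w⊓≡0 vc)) ⟩
    edgeCount m w⊔ + edgeCount m w⊓
      ≤⟨ +-mono-≤ (edgeCount≤ w⊔ (VC≤-w⊔ vc)) (edgeCount≤ {d = 0} w⊓ (VC≤-0 w⊓ (VC≤0⇒w⊓≡0 vc))) ⟩
    0 ∎
  bound (suc d) vc = begin
    ∑ᶜ m w⊓ + (edgeCount m w⊔ + edgeCount m w⊓)
      ≤⟨ +-monoʳ-≤ (∑ᶜ m w⊓) (+-mono-≤ (edgeCount≤ w⊔ (VC≤-w⊔ vc)) (edgeCount≤ w⊓ (VC≤-w⊓ vc))) ⟩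
    ∑ᶜ m w⊓ + (suc d * ∑ᶜ m w⊔ + d * ∑ᶜ m w⊓)
      ≡⟨ regroup d (∑ᶜ m w⊓) (∑ᶜ m w⊔) ⟩
    suc d * (∑ᶜ m w⊔ + ∑ᶜ m w⊓) ∎
    where
    regroup : ∀ d x y → x + (suc d * y + d * x) ≡ suc d * (y + x)
    regroup = solve-∀

-- Patterns of rows on sequences of columns

VCdim≤ : ∀ {m n} → SignMatrix m n → ℕ → Set
VCdim≤ {n = n} S d = (C : Subset n) → Shattered S C → ∣ C ∣ ≤ d

∈-[]≔inside : ∀ {n} (p : Subset n) x j → j Subset.∈ p [ x ]≔ inside → j ≡ x ⊎ j Subset.∈ p
∈-[]≔inside (b ∷ p) zero    zero    _          = inj₁ refl
∈-[]≔inside (b ∷ p) zero    (suc j) (there j∈) = inj₂ (there j∈)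
∈-[]≔inside (b ∷ p) (suc x) zero    here       = inj₂ here
∈-[]≔inside (b ∷ p) (suc x) (suc j) (there j∈) with ∈-[]≔inside p x j j∈
... | inj₁ j≡x = inj₁ (cong suc j≡x)
... | inj₂ j∈p = inj₂ (there j∈p)

∣[]≔inside∣ : ∀ {n} (p : Subset n) x → x Subset.∉ p → ∣ p [ x ]≔ inside ∣ ≡ suc ∣ p ∣
∣[]≔inside∣ (inside  ∷ p) zero    x∉p = ⊥-elim (x∉p here)
∣[]≔inside∣ (outside ∷ p) zero    x∉p = refl
∣[]≔inside∣ (inside  ∷ p) (suc x) x∉p = cong suc (∣[]≔inside∣ p x (x∉p ∘ there))
∣[]≔inside∣ (outside ∷ p) (suc x) x∉p = ∣[]≔inside∣ p x (x∉p ∘ there)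

module _ {m n : ℕ} (S : SignMatrix m n) where

  columnsAt : ∀ {s} → Vec (Fin n) s → Subset s → Subset n
  columnsAt []      []            = ⊥
  columnsAt (x ∷ A) (inside  ∷ T) = columnsAt A T [ x ]≔ inside
  columnsAt (x ∷ A) (outside ∷ T) = columnsAt A T

  RowsShatter : ∀ {s} → Vec (Fin n) s → Subset s → Set
  RowsShatter {s} A T = ∀ (v : Vec Sign s) → Σ (Fin m) λ i → AgreeOn T (map (S i) A) v

  AgreeOn-columnsAt : ∀ {s} (A : Vec (Fin n) s) T i (p : Fin n → Sign) →
    AgreeOn T (map (S i) A) (map p A) → ∀ j → j Subset.∈ columnsAt A T → S i j ≡ p j
  AgreeOn-columnsAt []      []            i p _              j j∈ = ⊥-elim (∉⊥ j∈)
  AgreeOn-columnsAt (x ∷ A) (inside  ∷ T) i p (Six≡px , agree) j j∈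
    with ∈-[]≔inside (columnsAt A T) x j j∈
  ... | inj₁ refl = Six≡px
  ... | inj₂ j∈′  = AgreeOn-columnsAt A T i p agree j j∈′
  AgreeOn-columnsAt (x ∷ A) (outside ∷ T) i p agree j j∈ = AgreeOn-columnsAt A T i p agree j j∈

  RowsShatter-tail : ∀ {s} x (A : Vec (Fin n) s) b T → RowsShatter (x ∷ A) (b ∷ T) → RowsShatter A T
  RowsShatter-tail x A inside  T sh v = let i , _ , agree = sh (plus ∷ v) in i , agree
  RowsShatter-tail x A outside T sh v = sh (plus ∷ v)

  RowsShatter⇒∉ : ∀ {s} x (A : Vec (Fin n) s) T →
    RowsShatter (x ∷ A) (inside ∷ T) → x Subset.∉ columnsAt A T
  RowsShatter⇒∉ x A T sh x∈ with sh (plus ∷ map (λ _ → minus) A)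
  ... | i , Six≡plus , agree with trans (sym Six≡plus) (AgreeOn-columnsAt A T i (λ _ → minus) agree x x∈)
  ... | ()

  RowsShatter⇒∣T∣≤ : ∀ {s} (A : Vec (Fin n) s) T → RowsShatter A T → ∣ T ∣ ≤ ∣ columnsAt A T ∣
  RowsShatter⇒∣T∣≤ []      []            sh = z≤n
  RowsShatter⇒∣T∣≤ (x ∷ A) (inside  ∷ T) sh =
    subst (suc ∣ T ∣ ≤_) (sym (∣[]≔inside∣ (columnsAt A T) x (RowsShatter⇒∉ x A T sh)))
      (s≤s (RowsShatter⇒∣T∣≤ A T (RowsShatter-tail x A inside T sh)))
  RowsShatter⇒∣T∣≤ (x ∷ A) (outside ∷ T) sh = RowsShatter⇒∣T∣≤ A T (RowsShatter-tail x A outside T sh)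

  RowsShatter⇒Shattered : ∀ {s} (A : Vec (Fin n) s) T → RowsShatter A T → Shattered S (columnsAt A T)
  RowsShatter⇒Shattered A T sh p = let i , agree = sh (map p A) in i , AgreeOn-columnsAt A T i p agree

  RowsShatter⇒∣T∣≤d : ∀ {d} → VCdim≤ S d →
    ∀ {s} (A : Vec (Fin n) s) T → RowsShatter A T → ∣ T ∣ ≤ d
  RowsShatter⇒∣T∣≤d vc A T sh =
    ≤-trans (RowsShatter⇒∣T∣≤ A T sh) (vc (columnsAt A T) (RowsShatter⇒Shattered A T sh))

  patternCount : ∀ {k s} → (Fin k → Fin m) → Vec (Fin n) s → Vec Sign s → ℕ
  patternCount {k} R A v = ∑[ a < k ] δᵛ (map (S (R a)) A) v

  ∑ᶜ-patternCount : ∀ {k s} (R : Fin k → Fin m) (A : Vec (Fin n) s) → ∑ᶜ s (patternCount R A) ≡ k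
  ∑ᶜ-patternCount {k} {s} R A = begin
    ∑ᶜ s (patternCount R A)                        ≡⟨ ∑ᵛ-comm s (λ v a → δᵛ (map (S (R a)) A) v) ⟩
    ∑[ a < k ] ∑ᶜ s (δᵛ (map (S (R a)) A))         ≡⟨ sum-cong-≗ {k} (λ a → ∑ᶜ-δᵛ s (map (S (R a)) A)) ⟩
    ∑[ a < k ] 1                                   ≡⟨ sum-const k 1 ⟩
    k * 1                                          ≡⟨ *-identityʳ k ⟩
    k                                              ∎
    where open ≡-Reasoning

  VC≤-patternCount : ∀ {d k s} → VCdim≤ S d →
    (R : Fin k → Fin m) (A : Vec (Fin n) s) → VC≤ d (patternCount R A)
  VC≤-patternCount vc R A T sh = RowsShatter⇒∣T∣≤d vc A T rowsShatter
    where
    rowsShatter : RowsShatter A T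
    rowsShatter v with sh v
    ... | u , 0<count , agree with sum-pos _ 0<count
    ... | a , 0<δ = R a , subst (λ z → AgreeOn T z v) (sym (δᵛ-pos _ _ 0<δ)) agree

-- Haussler's packing lemma

dist : ∀ {n} → (Fin n → ℕ) → (Fin n → Sign) → (Fin n → Sign) → ℕ
dist {n} μ x y = ∑[ j < n ] (μ j * disagree (x j) (y j))

dist≤sum : ∀ {n} (μ : Fin n → ℕ) x y → dist μ x y ≤ sum μ
dist≤sum μ x y = sum-mono-≤ (λ j →
  ≤-trans (*-monoʳ-≤ (μ j) (disagree≤1 (x j) (y j))) (≤-reflexive (*-identityʳ (μ j))))

signCount : ∀ {k} → (Fin k → ℕ) → (Fin k → Sign) → Sign → ℕ
signCount {k} g x s = ∑[ a < k ] (δ (x a) s * g a)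

signCount-plus+minus : ∀ {k} (g : Fin k → ℕ) x → signCount g x plus + signCount g x minus ≡ sum g
signCount-plus+minus {k} g x = trans (sym (∑-distrib-+ {k} _ _)) (sum-cong-≗ {k} λ a →
  trans (sym (*-distribʳ-+ (g a) (δ (x a) plus) _)) (trans (cong (_* g a) (δ-plus+minus (x a))) (*-identityˡ _)))
  where
  δ-plus+minus : ∀ s → δ s plus + δ s minus ≡ 1
  δ-plus+minus plus  = refl
  δ-plus+minus minus = refl

∑∑-disagree : ∀ {k} (g : Fin k → ℕ) (x : Fin k → Sign) →
  ∑[ a < k ] ∑[ b < k ] (g a * g b * disagree (x a) (x b))
    ≡ 2 * (signCount g x plus * signCount g x minus)
∑∑-disagree {k} g x = begin
  ∑[ a < k ] ∑[ b < k ] (g a * g b * disagree (x a) (x b))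
    ≡⟨ sum-cong-≗ {k} (λ a → sum-cong-≗ {k} (λ b → expand (x a) (x b) (g a) (g b))) ⟩
  ∑[ a < k ] ∑[ b < k ] (P a * M b + M a * P b)
    ≡⟨ sum-cong-≗ {k} (λ a → ∑-distrib-+ {k} _ _) ⟩
  ∑[ a < k ] (∑[ b < k ] (P a * M b) + ∑[ b < k ] (M a * P b))
    ≡⟨ ∑-distrib-+ {k} _ _ ⟩
  ∑[ a < k ] ∑[ b < k ] (P a * M b) + ∑[ a < k ] ∑[ b < k ] (M a * P b)
    ≡⟨ cong₂ _+_ (∑∑-product P M) (∑∑-product M P) ⟩
  sum P * sum M + sum M * sum P
    ≡⟨ cong (sum P * sum M +_) (trans (*-comm (sum M) (sum P)) (sym (+-identityʳ _))) ⟩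
  2 * (sum P * sum M) ∎
  where
  open ≡-Reasoning
  P M : Fin k → ℕ
  P a = δ (x a) plus * g a
  M a = δ (x a) minus * g a
  expand : ∀ s t m n →
    m * n * disagree s t ≡ δ s plus * m * (δ t minus * n) + δ s minus * m * (δ t plus * n)
  expand s t m n = trans (cong (m * n *_) (disagree-δ s t))
                         (regroup (δ s plus) (δ s minus) (δ t plus) (δ t minus) m n)
    where
    regroup : ∀ p q p′ q′ m n → m * n * (p * q′ + q * p′) ≡ p * m * (q′ * n) + q * m * (p′ * n)
    regroup = solve-∀

∑∑-dist : ∀ {k n} (μ : Fin n → ℕ) (g : Fin k → ℕ) (x : Fin k → Fin n → Sign) →
  ∑[ a < k ] ∑[ b < k ] (g a * g b * dist μ (x a) (x b))
    ≡ ∑[ j < n ] (μ j * (2 * (signCount g (λ a → x a j) plus * signCount g (λ a → x a j) minus)))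
∑∑-dist {k} {n} μ g x = begin
  ∑[ a < k ] ∑[ b < k ] (g a * g b * dist μ (x a) (x b))
    ≡⟨ sum-cong-≗ {k} (λ a → sum-cong-≗ {k} (λ b → trans (*-distribˡ-sum {n} (g a * g b) _)
         (sum-cong-≗ {n} (λ j → swap-μ (g a * g b) (μ j) _)))) ⟩
  ∑[ a < k ] ∑[ b < k ] ∑[ j < n ] (μ j * T j a b)
    ≡⟨ sum-cong-≗ {k} (λ a → ∑-comm {k} {n} _) ⟩
  ∑[ a < k ] ∑[ j < n ] ∑[ b < k ] (μ j * T j a b)
    ≡⟨ ∑-comm {k} {n} _ ⟩
  ∑[ j < n ] ∑[ a < k ] ∑[ b < k ] (μ j * T j a b)
    ≡⟨ sum-cong-≗ {n} (λ j → trans (sum-cong-≗ {k} (λ a → sym (*-distribˡ-sum {k} (μ j) _)))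
                                    (sym (*-distribˡ-sum {k} (μ j) _))) ⟩
  ∑[ j < n ] (μ j * ∑[ a < k ] ∑[ b < k ] T j a b)
    ≡⟨ sum-cong-≗ {n} (λ j → cong (μ j *_) (∑∑-disagree g (λ a → x a j))) ⟩
  ∑[ j < n ] (μ j * (2 * (signCount g (λ a → x a j) plus * signCount g (λ a → x a j) minus))) ∎
  where
  open ≡-Reasoning
  T : Fin n → Fin k → Fin k → ℕ
  T j a b = g a * g b * disagree (x a j) (x b j)
  swap-μ : ∀ c m e → c * (m * e) ≡ m * (c * e)
  swap-μ = solve-∀

m*n≤[m+n]*[m⊓n] : ∀ m n → m * n ≤ (m + n) * (m ⊓ n)
m*n≤[m+n]*[m⊓n] m n with ≤-total m n
... | inj₁ m≤n = begin
  m * n            ≡⟨ *-comm m n ⟩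
  n * m            ≤⟨ *-monoˡ-≤ m (m≤n+m n m) ⟩
  (m + n) * m      ≡⟨ cong ((m + n) *_) (m≤n⇒m⊓n≡m m≤n) ⟨
  (m + n) * (m ⊓ n) ∎
  where open ≤-Reasoning
... | inj₂ n≤m = begin
  m * n            ≤⟨ *-monoˡ-≤ n (m≤m+n m n) ⟩
  (m + n) * n      ≡⟨ cong ((m + n) *_) (m≥n⇒m⊓n≡n n≤m) ⟨
  (m + n) * (m ⊓ n) ∎
  where open ≤-Reasoning

Separated : ∀ {k n} → (Fin n → ℕ) → (Fin k → Fin n → Sign) → ℕ → ℕ → Set
Separated μ x t D = ∀ a b → a ≢ b → D ≤ t * dist μ (x a) (x b)

D*[∑g∸1]≤ : ∀ {k n} {μ : Fin n → ℕ} {x : Fin k → Fin n → Sign} {t D} → Separated μ x t D →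
  ∀ (g : Fin k → ℕ) a → g a ≡ 1 → D * (sum g ∸ 1) ≤ t * ∑[ b < k ] (g b * dist μ (x a) (x b))
D*[∑g∸1]≤ {suc k} {μ = μ} {x} {t} {D} separated g a ga≡1 = begin
  D * (sum g ∸ 1)
    ≡⟨ cong (λ z → D * (z ∸ 1)) (sum-remove {i = a} g) ⟩
  D * (g a + ∑[ c < k ] g (punchIn a c) ∸ 1)
    ≡⟨ cong (λ z → D * (z + ∑[ c < k ] g (punchIn a c) ∸ 1)) ga≡1 ⟩
  D * ∑[ c < k ] g (punchIn a c)
    ≡⟨ *-distribˡ-sum {k} D _ ⟩
  ∑[ c < k ] (D * g (punchIn a c))
    ≤⟨ sum-mono-≤ (λ c → separated-at (punchIn a c) (Fin.punchInᵢ≢i a c ∘ sym)) ⟩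
  ∑[ c < k ] (t * h (punchIn a c))
    ≡⟨ *-distribˡ-sum {k} t _ ⟨
  t * ∑[ c < k ] h (punchIn a c)
    ≤⟨ *-monoʳ-≤ t (m≤n+m _ (h a)) ⟩
  t * (h a + ∑[ c < k ] h (punchIn a c))
    ≡⟨ cong (t *_) (sum-remove {i = a} h) ⟨
  t * sum h ∎
  where
  open ≤-Reasoning
  h : Fin (suc k) → ℕ
  h b = g b * dist μ (x a) (x b)
  separated-at : ∀ b → a ≢ b → D * g b ≤ t * h b
  separated-at b a≢b = begin
    D * g b                   ≡⟨ *-comm D (g b) ⟩
    g b * D                   ≤⟨ *-monoʳ-≤ (g b) (separated a b a≢b) ⟩
    g b * (t * dist μ (x a) (x b))  ≡⟨ swap (g b) t _ ⟩
    t * h b                   ∎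
    where
    swap : ∀ m n o → m * (n * o) ≡ n * (m * o)
    swap = solve-∀

*-cancelˡ-≤-∸1 : ∀ w {a b} → w * (a * (w ∸ 1)) ≤ w * b → a * (w ∸ 1) ≤ b
*-cancelˡ-≤-∸1 zero    {a} {b} _ = subst (_≤ b) (sym (*-zeroʳ a)) z≤n
*-cancelˡ-≤-∸1 (suc w)         le = *-cancelˡ-≤ (suc w) le

-- Double counting the distances within a cluster of w = sum g points: separation gives at least
-- (D / t) w (w - 1), while coordinate j contributes 2 μ j #plus #minus ≤ 2 w μ j min(#plus, #minus).
clusterBound : ∀ {k n} {μ : Fin n → ℕ} {x : Fin k → Fin n → Sign} {t D} → Separated μ x t D →
  ∀ (g : Fin k → ℕ) → (∀ a → g a ≡ 0 ⊎ g a ≡ 1) →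
  D * (sum g ∸ 1) ≤
    t * (2 * ∑[ j < n ] (μ j * (signCount g (λ a → x a j) plus ⊓ signCount g (λ a → x a j) minus)))
clusterBound {k} {n} {μ} {x} {t} {D} separated g g∈01 = *-cancelˡ-≤-∸1 w {D} (begin
  w * (D * (w ∸ 1))
    ≡⟨ swap w D (w ∸ 1) ⟩
  D * (w * (w ∸ 1))
    ≡⟨ cong (D *_) (*-distribʳ-sum {k} (w ∸ 1) g) ⟩
  D * ∑[ a < k ] (g a * (w ∸ 1))
    ≡⟨ *-distribˡ-sum {k} D _ ⟩
  ∑[ a < k ] (D * (g a * (w ∸ 1)))
    ≤⟨ sum-mono-≤ pointwise ⟩
  ∑[ a < k ] (t * ∑[ b < k ] (g a * g b * dist μ (x a) (x b)))
    ≡⟨ *-distribˡ-sum {k} t _ ⟨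
  t * ∑[ a < k ] ∑[ b < k ] (g a * g b * dist μ (x a) (x b))
    ≡⟨ cong (t *_) (∑∑-dist μ g x) ⟩
  t * ∑[ j < n ] (μ j * (2 * (P j * M j)))
    ≤⟨ *-monoʳ-≤ t (sum-mono-≤ (λ j → *-monoʳ-≤ (μ j) (*-monoʳ-≤ 2 (PM≤w*min j)))) ⟩
  t * ∑[ j < n ] (μ j * (2 * (w * (P j ⊓ M j))))
    ≡⟨ cong (t *_) (sum-cong-≗ {n} (λ j → swap₃ (μ j) w (P j ⊓ M j))) ⟩
  t * ∑[ j < n ] (w * (2 * (μ j * (P j ⊓ M j))))
    ≡⟨ cong (t *_) (*-distribˡ-sum {n} w _) ⟨
  t * (w * ∑[ j < n ] (2 * (μ j * (P j ⊓ M j))))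
    ≡⟨ cong (λ z → t * (w * z)) (*-distribˡ-sum {n} 2 _) ⟨
  t * (w * (2 * ∑[ j < n ] (μ j * (P j ⊓ M j))))
    ≡⟨ swap t w _ ⟩
  w * (t * (2 * ∑[ j < n ] (μ j * (P j ⊓ M j)))) ∎)
  where
  open ≤-Reasoning
  w = sum g
  P M : Fin n → ℕ
  P j = signCount g (λ a → x a j) plus
  M j = signCount g (λ a → x a j) minus
  PM≤w*min : ∀ j → P j * M j ≤ w * (P j ⊓ M j)
  PM≤w*min j = subst (λ z → P j * M j ≤ z * (P j ⊓ M j)) (signCount-plus+minus g (λ a → x a j))
                     (m*n≤[m+n]*[m⊓n] (P j) (M j))
  swap : ∀ m n o → m * (n * o) ≡ n * (m * o)
  swap = solve-∀
  swap₃ : ∀ m w e → m * (2 * (w * e)) ≡ w * (2 * (m * e))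
  swap₃ = solve-∀
  pointwise : ∀ a → D * (g a * (w ∸ 1)) ≤ t * ∑[ b < k ] (g a * g b * dist μ (x a) (x b))
  pointwise a with g∈01 a
  ... | inj₁ ga≡0 rewrite ga≡0 | *-zeroʳ D = z≤n
  ... | inj₂ ga≡1 rewrite ga≡1 = begin
    D * (w ∸ 1 + 0)
      ≡⟨ cong (D *_) (+-identityʳ _) ⟩
    D * (w ∸ 1)
      ≤⟨ D*[∑g∸1]≤ {μ = μ} {x} {t} {D} separated g a ga≡1 ⟩
    t * ∑[ b < k ] (g b * dist μ (x a) (x b))
      ≡⟨ cong (t *_) (sum-cong-≗ {k} (λ b → cong (_* _) (+-identityʳ (g b)))) ⟨
    t * ∑[ b < k ] ((g b + 0) * dist μ (x a) (x b)) ∎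

∸1+indicator : ∀ x → x ∸ 1 + indicator x ≡ x
∸1+indicator zero    = refl
∸1+indicator (suc x) = +-comm x 1

twoDistinct : ∀ {k} → 2 ≤ k → Σ (Fin k) λ a → Σ (Fin k) λ b → a ≢ b
twoDistinct {suc (suc k)} _               = zero , suc zero , λ ()
twoDistinct {suc zero}    (s≤s ())

module Packing {m n} (S : SignMatrix m n) {d} (vc : VCdim≤ S d)
               {k} (R : Fin k → Fin m) (μ : Fin n → ℕ) where

  rows : Fin k → Fin n → Sign
  rows a = S (R a)

  count : ∀ {s} → Vec (Fin n) s → Vec Sign s → ℕ
  count = patternCount S R

  -- The μ-weighted number of edges of the one-inclusion graph gained by adding one column to A.
  splitWeight : ∀ {s} → Vec (Fin n) s → ℕ
  splitWeight A = ∑[ i < n ] (μ i * edges zero (count (i ∷ A)))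

  signCount-cell : ∀ {s} (A : Vec (Fin n) s) u i b →
    signCount (λ a → δᵛ (map (rows a) A) u) (λ a → rows a i) b ≡ count (i ∷ A) (b ∷ u)
  signCount-cell A u i b = sum-cong-≗ {k} (λ a → sym (δᵛ-∷ (rows a i) b (map (rows a) A) u))

  excess+support≡k : ∀ {s} (A : Vec (Fin n) s) →
    ∑ᶜ s (λ u → count A u ∸ 1) + support (count A) ≡ k
  excess+support≡k {s} A = begin
    ∑ᶜ s (λ u → count A u ∸ 1) + support (count A)   ≡⟨ ∑ᵛ-distrib-+ s _ _ ⟨
    ∑ᶜ s (λ u → count A u ∸ 1 + indicator (count A u)) ≡⟨ ∑ᵛ-cong s (λ u → ∸1+indicator (count A u)) ⟩
    ∑ᶜ s (count A)                                    ≡⟨ ∑ᶜ-patternCount S R A ⟩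
    k                                                 ∎
    where open ≡-Reasoning

  k≤2*excess : ∀ {s} (A : Vec (Fin n) s) → 2 * suc s ^ d ≤ k → k ≤ 2 * ∑ᶜ s (λ u → count A u ∸ 1)
  k≤2*excess {s} A 2T≤k = begin
    k                ≡⟨ excess+support≡k A ⟨
    excess + support (count A) ≤⟨ +-monoʳ-≤ excess support≤T ⟩
    excess + T       ≤⟨ +-monoʳ-≤ excess T≤excess ⟩
    excess + excess  ≡⟨ cong (excess +_) (+-identityʳ excess) ⟨
    2 * excess       ∎
    where
    open ≤-Reasoning
    excess = ∑ᶜ s (λ u → count A u ∸ 1)
    T = suc s ^ d
    support≤T : support (count A) ≤ T
    support≤T = sauer-shelah (count A) (VC≤-patternCount S vc R A)
    T≤excess : T ≤ excess
    T≤excess = +-cancelʳ-≤ T T excess (begin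
      T + T                       ≡⟨ cong (T +_) (+-identityʳ T) ⟨
      2 * T                       ≤⟨ 2T≤k ⟩
      k                           ≡⟨ excess+support≡k A ⟨
      excess + support (count A)  ≤⟨ +-monoʳ-≤ excess support≤T ⟩
      excess + T                  ∎)

  D*k≤4t*splitWeight : ∀ {t D} → Separated μ rows t D → ∀ {s} (A : Vec (Fin n) s) →
    2 * suc s ^ d ≤ k → D * k ≤ 4 * t * splitWeight A
  D*k≤4t*splitWeight {t} {D} separated {s} A 2T≤k = begin
    D * k
      ≤⟨ *-monoʳ-≤ D (k≤2*excess A 2T≤k) ⟩
    D * (2 * ∑ᶜ s (λ u → count A u ∸ 1))
      ≡⟨ swap D 2 _ ⟩
    2 * (D * ∑ᶜ s (λ u → count A u ∸ 1))
      ≡⟨ cong (2 *_) (*-distribˡ-∑ᵛ s D (λ u → count A u ∸ 1)) ⟨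
    2 * ∑ᶜ s (λ u → D * (count A u ∸ 1))
      ≤⟨ *-monoʳ-≤ 2 (∑ᵛ-mono-≤ s cluster) ⟩
    2 * ∑ᶜ s (λ u → t * (2 * Y u))
      ≡⟨ cong (2 *_) (trans (*-distribˡ-∑ᵛ s t _) (cong (t *_) (*-distribˡ-∑ᵛ s 2 Y))) ⟩
    2 * (t * (2 * ∑ᶜ s Y))
      ≡⟨ cong (λ z → 2 * (t * (2 * z))) ∑ᶜY≡splitWeight ⟩
    2 * (t * (2 * splitWeight A))
      ≡⟨ regroup t (splitWeight A) ⟩
    4 * t * splitWeight A ∎
    where
    open ≤-Reasoning
    Y : Vec Sign s → ℕ
    Y u = ∑[ i < n ] (μ i * (count (i ∷ A) (plus ∷ u) ⊓ count (i ∷ A) (minus ∷ u)))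
    cluster : ∀ u → D * (count A u ∸ 1) ≤ t * (2 * Y u)
    cluster u = subst (λ z → D * (count A u ∸ 1) ≤ t * (2 * z))
      (sum-cong-≗ {n} (λ i → cong (μ i *_)
        (cong₂ _⊓_ (signCount-cell A u i plus) (signCount-cell A u i minus))))
      (clusterBound {μ = μ} {rows} {t} {D} separated
        (λ a → δᵛ (map (rows a) A) u) (λ a → δᵛ≡0⊎δᵛ≡1 (map (rows a) A) u))
    ∑ᶜY≡splitWeight : ∑ᶜ s Y ≡ splitWeight A
    ∑ᶜY≡splitWeight = trans (∑ᵛ-comm s {n} _) (sum-cong-≗ {n} (λ i → *-distribˡ-∑ᵛ s (μ i) _))
    swap : ∀ a b c → a * (b * c) ≡ b * (a * c)
    swap = solve-∀
    regroup : ∀ t x → 2 * (t * (2 * x)) ≡ 4 * t * x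
    regroup = solve-∀

  ∑ᵗ : ∀ s → (Vec (Fin n) s → ℕ) → ℕ
  ∑ᵗ = ∑ᵛ id

  μᵛ : ∀ {s} → Vec (Fin n) s → ℕ
  μᵛ []      = 1
  μᵛ (i ∷ A) = μ i * μᵛ A

  W : ℕ
  W = sum μ

  ∑ᵗ-μᵛ : ∀ s → ∑ᵗ s μᵛ ≡ W ^ s
  ∑ᵗ-μᵛ zero    = refl
  ∑ᵗ-μᵛ (suc s) = begin
    ∑[ i < n ] ∑ᵗ s (λ A → μ i * μᵛ A)  ≡⟨ sum-cong-≗ {n} (λ i → *-distribˡ-∑ᵛ s (μ i) μᵛ) ⟩
    ∑[ i < n ] (μ i * ∑ᵗ s μᵛ)           ≡⟨ sum-cong-≗ {n} (λ i → cong (μ i *_) (∑ᵗ-μᵛ s)) ⟩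
    ∑[ i < n ] (μ i * W ^ s)             ≡⟨ *-distribʳ-sum {n} (W ^ s) μ ⟨
    W ^ suc s                            ∎
    where open ≡-Reasoning

  μᵛ-insertAt : ∀ {s} (A : Vec (Fin n) s) p i → μᵛ (insertAt A p i) ≡ μ i * μᵛ A
  μᵛ-insertAt A       zero    i = refl
  μᵛ-insertAt (j ∷ A) (suc p) i = trans (cong (μ j *_) (μᵛ-insertAt A p i)) (swap (μ j) (μ i) (μᵛ A))
    where
    swap : ∀ a b c → a * (b * c) ≡ b * (a * c)
    swap = solve-∀

  count-insertAt : ∀ {s} (A : Vec (Fin n) s) u p i b →
    count (insertAt A p i) (insertAt u p b) ≡ count (i ∷ A) (b ∷ u)
  count-insertAt A u p i b = sum-cong-≗ {k} λ a → begin
    δᵛ (map (rows a) (insertAt A p i)) (insertAt u p b)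
      ≡⟨ cong (λ v → δᵛ v (insertAt u p b)) (map-insertAt (rows a) i A p) ⟩
    δᵛ (insertAt (map (rows a) A) p (rows a i)) (insertAt u p b)
      ≡⟨ δᵛ-insertAt (map (rows a) A) u p (rows a i) b ⟩
    δ (rows a i) b * δᵛ (map (rows a) A) u
      ≡⟨ δᵛ-∷ (rows a i) b (map (rows a) A) u ⟨
    δᵛ (rows a i ∷ map (rows a) A) (b ∷ u) ∎
    where open ≡-Reasoning

  ∑ᵗ-edges : ∀ s (p : Fin (suc s)) →
    ∑ᵗ (suc s) (λ A → μᵛ A * edges p (count A)) ≡ ∑ᵗ s (λ A → μᵛ A * splitWeight A)
  ∑ᵗ-edges s p = begin
    ∑ᵗ (suc s) (λ A → μᵛ A * edges p (count A))
      ≡⟨ ∑ᵛ-insertAt s p (λ A → μᵛ A * edges p (count A)) ⟩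
    ∑ᵗ s (λ A → ∑[ i < n ] (μᵛ (insertAt A p i) * edges p (count (insertAt A p i))))
      ≡⟨ ∑ᵛ-cong s (λ A → sum-cong-≗ {n} (λ i → cong₂ _*_ (μᵛ-insertAt A p i) (edges-insertAt A i))) ⟩
    ∑ᵗ s (λ A → ∑[ i < n ] (μ i * μᵛ A * edges zero (count (i ∷ A))))
      ≡⟨ ∑ᵛ-cong s (λ A → trans (sum-cong-≗ {n} (λ i → swap (μ i) (μᵛ A) _))
                                (sym (*-distribˡ-sum {n} (μᵛ A) _))) ⟩
    ∑ᵗ s (λ A → μᵛ A * splitWeight A) ∎
    where
    open ≡-Reasoning
    edges-insertAt : ∀ A i → edges p (count (insertAt A p i)) ≡ edges zero (count (i ∷ A))
    edges-insertAt A i =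
      ∑ᵛ-cong s (λ u → cong₂ _⊓_ (count-insertAt A u p i plus) (count-insertAt A u p i minus))
    swap : ∀ a b c → a * b * c ≡ b * (a * c)
    swap = solve-∀

  ∑ᵗ-edgeCount : ∀ s → ∑ᵗ (suc s) (λ A → μᵛ A * edgeCount (suc s) (count A))
                       ≡ suc s * ∑ᵗ s (λ A → μᵛ A * splitWeight A)
  ∑ᵗ-edgeCount s = begin
    ∑ᵗ (suc s) (λ A → μᵛ A * edgeCount (suc s) (count A))
      ≡⟨ ∑ᵛ-cong {enum = id} (suc s) (λ A → *-distribˡ-sum {suc s} (μᵛ A) (λ p → edges p (count A))) ⟩
    ∑ᵗ (suc s) (λ A → ∑[ p < suc s ] (μᵛ A * edges p (count A)))
      ≡⟨ ∑ᵛ-comm {enum = id} (suc s) (λ A p → μᵛ A * edges p (count A)) ⟩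
    ∑[ p < suc s ] ∑ᵗ (suc s) (λ A → μᵛ A * edges p (count A))
      ≡⟨ sum-cong-≗ {suc s} (∑ᵗ-edges s) ⟩
    ∑[ p < suc s ] ∑ᵗ s (λ A → μᵛ A * splitWeight A)
      ≡⟨ sum-const (suc s) (∑ᵗ s (λ A → μᵛ A * splitWeight A)) ⟩
    suc s * ∑ᵗ s (λ A → μᵛ A * splitWeight A) ∎
    where open ≡-Reasoning

  -- Haussler's packing argument: if the rows were pairwise far apart, the edge bound
  -- averaged over column tuples drawn from μ would fail.
  closePair : ∀ s → 2 * suc s ^ d ≤ k →
    ∃ λ a → ∃ λ b → a ≢ b × suc s * dist μ (rows a) (rows b) ≤ 4 * d * W
  closePair s 2T≤k
    with Fin.any? (λ a → Fin.any? (λ b →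
           ¬? (a Fin.≟ b) ×-dec (suc s * dist μ (rows a) (rows b) ≤? 4 * d * W)))
  ... | yes (a , b , a≢b , close) = a , b , a≢b , close
  ... | no noClosePair = ⊥-elim (<-irrefl refl (*-cancelˡ-≤ (W ^ s * k) {{W^s*k≢0}} averaged))
    where
    t = suc s
    D = suc (4 * d * W)
    separated : Separated μ rows t D
    separated a b a≢b = ≰⇒> (λ close → noClosePair (a , b , a≢b , close))
    2≤k : 2 ≤ k
    2≤k = ≤-trans (*-monoʳ-≤ 2 (m^n>0 t d)) 2T≤k
    W≢0 : NonZero W
    W≢0 with twoDistinct 2≤k
    ... | a , b , a≢b = m*n≢0⇒n≢0 t {{>-nonZero
      (≤-trans (s≤s z≤n) (≤-trans (separated a b a≢b) (*-monoʳ-≤ t (dist≤sum μ _ _))))}}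
    W^s*k≢0 : NonZero (W ^ s * k)
    W^s*k≢0 = m*n≢0 (W ^ s) k {{m^n≢0 W s {{W≢0}}}} {{>-nonZero (≤-trans (s≤s z≤n) 2≤k)}}
    averaged : W ^ s * k * D ≤ W ^ s * k * (4 * d * W)
    averaged = begin
      W ^ s * k * D
        ≡⟨ regroup₁ (W ^ s) k D ⟩
      W ^ s * (D * k)
        ≡⟨ cong (_* (D * k)) (∑ᵗ-μᵛ s) ⟨
      ∑ᵗ s μᵛ * (D * k)
        ≡⟨ *-distribʳ-∑ᵛ s (D * k) μᵛ ⟨
      ∑ᵗ s (λ A → μᵛ A * (D * k))
        ≤⟨ ∑ᵛ-mono-≤ s (λ A → *-monoʳ-≤ (μᵛ A) (D*k≤4t*splitWeight {t} {D} separated A 2T≤k)) ⟩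
      ∑ᵗ s (λ A → μᵛ A * (4 * t * splitWeight A))
        ≡⟨ ∑ᵛ-cong s (λ A → regroup₂ (μᵛ A) (4 * t) (splitWeight A)) ⟩
      ∑ᵗ s (λ A → 4 * t * (μᵛ A * splitWeight A))
        ≡⟨ *-distribˡ-∑ᵛ s (4 * t) _ ⟩
      4 * t * ∑ᵗ s (λ A → μᵛ A * splitWeight A)
        ≡⟨ *-assoc 4 t _ ⟩
      4 * (t * ∑ᵗ s (λ A → μᵛ A * splitWeight A))
        ≡⟨ cong (4 *_) (∑ᵗ-edgeCount s) ⟨
      4 * ∑ᵗ t (λ A → μᵛ A * edgeCount t (count A))
        ≤⟨ *-monoʳ-≤ 4 (∑ᵛ-mono-≤ {enum = id} t (λ A → *-monoʳ-≤ (μᵛ A) (edgeCount≤k A))) ⟩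
      4 * ∑ᵗ t (λ A → μᵛ A * (d * k))
        ≡⟨ cong (4 *_) (*-distribʳ-∑ᵛ {enum = id} t (d * k) μᵛ) ⟩
      4 * (∑ᵗ t μᵛ * (d * k))
        ≡⟨ cong (λ z → 4 * (z * (d * k))) (∑ᵗ-μᵛ t) ⟩
      4 * (W * W ^ s * (d * k))
        ≡⟨ regroup₃ W (W ^ s) d k ⟩
      W ^ s * k * (4 * d * W) ∎
      where
      open ≤-Reasoning
      edgeCount≤k : ∀ A → edgeCount t (count A) ≤ d * k
      edgeCount≤k A = subst (λ z → edgeCount t (count A) ≤ d * z) (∑ᶜ-patternCount S R A)
                            (edgeCount≤ (count A) (VC≤-patternCount S vc R A))
      regroup₁ : ∀ a k D → a * k * D ≡ a * (D * k)
      regroup₁ = solve-∀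
      regroup₂ : ∀ a b c → a * (b * c) ≡ b * (a * c)
      regroup₂ = solve-∀
      regroup₃ : ∀ W a d k → 4 * (W * a * (d * k)) ≡ a * k * (4 * d * W)
      regroup₃ = solve-∀

-- Welzl's path of low crossing number

2^[k+b] : ∀ k {b} → b ≤ 1 → 2 ^ (k + b) ≡ 2 ^ k + 2 ^ k * b
2^[k+b] k z≤n       =
  trans (cong (2 ^_) (+-identityʳ k)) (sym (trans (cong (2 ^ k +_) (*-zeroʳ (2 ^ k))) (+-identityʳ _)))
2^[k+b] k (s≤s z≤n) = trans (^-distribˡ-+-* 2 k 1) (double (2 ^ k))
  where
  double : ∀ x → x * (2 * 1) ≡ x + x * 1
  double = solve-∀

insertAfter : ∀ {A : Set} {y : A} (x : A) (L : List A) → y ∈ L → List A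
insertAfter x (a ∷ l) (here _)    = a ∷ x ∷ l
insertAfter x (a ∷ l) (there y∈l) = a ∷ insertAfter x l y∈l

∈-insertAfter⁺ : ∀ {A : Set} {y z : A} x L (y∈L : y ∈ L) → z ∈ L → z ∈ insertAfter x L y∈L
∈-insertAfter⁺ x (a ∷ l) (here _)    (here z≡a)  = here z≡a
∈-insertAfter⁺ x (a ∷ l) (here _)    (there z∈l) = there (there z∈l)
∈-insertAfter⁺ x (a ∷ l) (there _)   (here z≡a)  = here z≡a
∈-insertAfter⁺ x (a ∷ l) (there y∈l) (there z∈l) = there (∈-insertAfter⁺ x l y∈l z∈l)

x∈insertAfter : ∀ {A : Set} {y : A} x L (y∈L : y ∈ L) → x ∈ insertAfter x L y∈L
x∈insertAfter x (a ∷ l) (here _)    = there (here refl)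
x∈insertAfter x (a ∷ l) (there y∈l) = there (x∈insertAfter x l y∈l)

module _ {m n : ℕ} (S : SignMatrix m n) where

  crossings-insertAfter : ∀ j {y} x L (y∈L : y ∈ L) →
    crossings S j (insertAfter x L y∈L) ≤ crossings S j L + 2 * disagree (S y j) (S x j)
  crossings-insertAfter j x (a ∷ [])    (here refl) = +-monoʳ-≤ (disagree (S a j) (S x j)) z≤n
  crossings-insertAfter j x (a ∷ b ∷ l) (here refl) = begin
    ax + (disagree (S x j) (S b j) + rest)
      ≤⟨ +-monoʳ-≤ ax (+-monoˡ-≤ rest (disagree-triangle (S x j) (S a j) (S b j))) ⟩
    ax + ((xa + ab) + rest)
      ≡⟨ cong (λ z → ax + ((z + ab) + rest)) (disagree-sym (S x j) (S a j)) ⟩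
    ax + ((ax + ab) + rest)
      ≡⟨ regroup ax ab rest ⟩
    (ab + rest) + 2 * ax ∎
    where
    open ≤-Reasoning
    ax = disagree (S a j) (S x j)
    xa = disagree (S x j) (S a j)
    ab = disagree (S a j) (S b j)
    rest = crossings S j (b ∷ l)
    regroup : ∀ p q r → p + ((p + q) + r) ≡ (q + r) + 2 * p
    regroup = solve-∀
  crossings-insertAfter j x (a ∷ b ∷ l) (there (here refl)) =
    ≤-trans (+-monoʳ-≤ (disagree (S a j) (S b j)) (crossings-insertAfter j x (b ∷ l) (here refl)))
            (≤-reflexive (sym (+-assoc (disagree (S a j) (S b j)) (crossings S j (b ∷ l)) _)))
  crossings-insertAfter j x (a ∷ b ∷ l) (there (there y∈l)) =
    ≤-trans (+-monoʳ-≤ (disagree (S a j) (S b j)) (crossings-insertAfter j x (b ∷ l) (there y∈l)))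
            (≤-reflexive (sym (+-assoc (disagree (S a j) (S b j)) (crossings S j (b ∷ l)) _)))

module Welzl {m n} (S : SignMatrix m n) {d} (vc : VCdim≤ S d) where

  weight : (Fin n → ℕ) → ℕ
  weight κ = ∑[ j < n ] (2 ^ κ j)

  -- Column j carries weight 2 ^ κ j, κ j counting how often it has been crossed so far;
  -- the path has raised the total weight by a factor of at most X / c.
  record CoveringPath {k} (R : Fin k → Fin m) (κ : Fin n → ℕ) (c X : ℕ) : Set where
    field
      path       : List (Fin m)
      κ′         : Fin n → ℕ
      covers     : ∀ a → R a ∈ path
      crossings≤ : ∀ j → crossings S j path + 2 * κ j ≤ 2 * κ′ j
      weight≤    : weight κ′ * c ≤ weight κ * X

  trivialPath : ∀ {k} (R : Fin k → Fin m) κ → k ≤ 1 → CoveringPath R κ 1 1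
  trivialPath {zero}  R κ _ = record
    { path = [] ; κ′ = κ ; covers = λ () ; crossings≤ = λ j → ≤-refl ; weight≤ = ≤-refl }
  trivialPath {suc zero} R κ _ = record
    { path = R zero ∷ [] ; κ′ = κ ; covers = λ { zero → here refl }
    ; crossings≤ = λ j → ≤-refl ; weight≤ = ≤-refl }
  trivialPath {suc (suc k)} R κ (s≤s ())

  weight-cross : ∀ κ (x y : Fin n → Sign) →
    weight (λ j → κ j + disagree (x j) (y j)) ≡ weight κ + dist (λ j → 2 ^ κ j) x y
  weight-cross κ x y =
    trans (sum-cong-≗ {n} (λ j → 2^[k+b] (κ j) (disagree≤1 (x j) (y j)))) (∑-distrib-+ {n} _ _)

  CoveringPath-mono : ∀ {k} {R : Fin k → Fin m} {κ c X c′ X′} → c′ ≤ c → X ≤ X′ →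
    CoveringPath R κ c X → CoveringPath R κ c′ X′
  CoveringPath-mono {κ = κ} c′≤c X≤X′ P = record
    { path = path ; κ′ = κ′ ; covers = covers ; crossings≤ = crossings≤
    ; weight≤ = ≤-trans (*-monoʳ-≤ (weight κ′) c′≤c) (≤-trans weight≤ (*-monoʳ-≤ (weight κ) X≤X′)) }
    where open CoveringPath P

  CoveringPath-cancel : ∀ {k} {R : Fin k → Fin m} {κ c X} q .{{_ : NonZero q}} →
    CoveringPath R κ (q * c) (q * X) → CoveringPath R κ c X
  CoveringPath-cancel {κ = κ} {c} {X} q P = record
    { path = path ; κ′ = κ′ ; covers = covers ; crossings≤ = crossings≤
    ; weight≤ = *-cancelˡ-≤ q (subst₂ _≤_ (swap (weight κ′) q c) (swap (weight κ) q X) weight≤) }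
    where
    open CoveringPath P
    swap : ∀ a b c → a * (b * c) ≡ b * (a * c)
    swap = solve-∀

  -- One step of Welzl's construction: drop one row a of a close pair (a, b), cover the
  -- others after doubling the weight of the columns separating a from b, and put a back next to b.
  extendByClosePair : ∀ {k c X} s → 2 * suc s ^ d ≤ suc (suc k) →
    (∀ (R′ : Fin (suc k) → Fin m) κ′ → CoveringPath R′ κ′ c X) →
    ∀ (R : Fin (suc (suc k)) → Fin m) κ → CoveringPath R κ (suc s * c) ((suc s + 4 * d) * X)
  extendByClosePair {k} {c} {X} s 2T≤k cover R κ
    with Packing.closePair S vc R (λ j → 2 ^ κ j) s 2T≤k
  ... | a , b , a≢b , close = record
    { path       = insertAfter x path y∈path
    ; κ′         = κ′
    ; covers     = covers′
    ; crossings≤ = crossings≤′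
    ; weight≤    = weight≤′
    }
    where
    μ : Fin n → ℕ
    μ j = 2 ^ κ j
    x = R a
    y = R b
    κ₁ : Fin n → ℕ
    κ₁ j = κ j + disagree (S x j) (S y j)
    open CoveringPath (cover (R ∘ punchIn a) κ₁)
    ∈path : ∀ {p} → a ≢ p → R p ∈ path
    ∈path {p} a≢p = subst (λ q → R q ∈ path) (Fin.punchIn-punchOut a≢p) (covers (punchOut a≢p))
    y∈path = ∈path a≢b
    covers′ : ∀ p → R p ∈ insertAfter x path y∈path
    covers′ p with a Fin.≟ p
    ... | yes refl = x∈insertAfter x path y∈path
    ... | no a≢p   = ∈-insertAfter⁺ x path y∈path (∈path a≢p)
    crossings≤′ : ∀ j → crossings S j (insertAfter x path y∈path) + 2 * κ j ≤ 2 * κ′ j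
    crossings≤′ j = begin
      crossings S j (insertAfter x path y∈path) + 2 * κ j
        ≤⟨ +-monoˡ-≤ (2 * κ j) (crossings-insertAfter S j x path y∈path) ⟩
      crossings S j path + 2 * disagree (S y j) (S x j) + 2 * κ j
        ≡⟨ cong (λ z → crossings S j path + 2 * z + 2 * κ j) (disagree-sym (S y j) (S x j)) ⟩
      crossings S j path + 2 * disagree (S x j) (S y j) + 2 * κ j
        ≡⟨ regroup (crossings S j path) (disagree (S x j) (S y j)) (κ j) ⟩
      crossings S j path + 2 * κ₁ j
        ≤⟨ crossings≤ j ⟩
      2 * κ′ j ∎
      where
      open ≤-Reasoning
      regroup : ∀ c e k → c + 2 * e + 2 * k ≡ c + 2 * (k + e)
      regroup = solve-∀
    weight≤′ : weight κ′ * (suc s * c) ≤ weight κ * ((suc s + 4 * d) * X)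
    weight≤′ = begin
      weight κ′ * (suc s * c)
        ≡⟨ swap (weight κ′) (suc s) c ⟩
      suc s * (weight κ′ * c)
        ≤⟨ *-monoʳ-≤ (suc s) weight≤ ⟩
      suc s * (weight κ₁ * X)
        ≡⟨ cong (λ z → suc s * (z * X)) (weight-cross κ (S x) (S y)) ⟩
      suc s * ((weight κ + dist μ (S x) (S y)) * X)
        ≡⟨ distribute (suc s) (weight κ) _ X ⟩
      (suc s * weight κ + suc s * dist μ (S x) (S y)) * X
        ≤⟨ *-monoˡ-≤ X (+-monoʳ-≤ (suc s * weight κ) close) ⟩
      (suc s * weight κ + 4 * d * weight κ) * X
        ≡⟨ factor (suc s) (weight κ) d X ⟩
      weight κ * ((suc s + 4 * d) * X) ∎
      where
      open ≤-Reasoning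
      swap : ∀ a b c → a * (b * c) ≡ b * (a * c)
      swap = solve-∀
      distribute : ∀ t w q X → t * ((w + q) * X) ≡ (t * w + t * q) * X
      distribute = solve-∀
      factor : ∀ t w d X → (t * w + 4 * d * w) * X ≡ w * ((t + 4 * d) * X)
      factor = solve-∀

  iterateSteps : ∀ {k₀ c X} s → 2 * suc s ^ d ≤ suc k₀ →
    (∀ (R : Fin k₀ → Fin m) κ → CoveringPath R κ c X) →
    ∀ i {k} → k ≡ i + k₀ → ∀ (R : Fin k → Fin m) κ →
    CoveringPath R κ (suc s ^ i * c) ((suc s + 4 * d) ^ i * X)
  iterateSteps {k₀} {c} {X} s 2T≤k₀ cover zero refl R κ =
    CoveringPath-mono (≤-reflexive (*-identityˡ c)) (≤-reflexive (sym (*-identityˡ X))) (cover R κ)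
  iterateSteps {zero} s 2T≤1 cover (suc i) refl R κ
    with ≤-trans (*-monoʳ-≤ 2 (m^n>0 (suc s) d)) 2T≤1
  ... | s≤s ()
  iterateSteps {suc k₀} s 2T≤k₀ cover (suc i) {suc zero} k≡ R κ
    with trans (suc-injective k≡) (+-suc i k₀)
  ... | ()
  iterateSteps {suc k₀} {c} {X} s 2T≤k₀ cover (suc i) {suc (suc k)} k≡ R κ =
    CoveringPath-mono (≤-reflexive (*-assoc (suc s) (suc s ^ i) c))
                      (≤-reflexive (sym (*-assoc (suc s + 4 * d) ((suc s + 4 * d) ^ i) X)))
      (extendByClosePair s
        (≤-trans 2T≤k₀ (s≤s (≤-trans (m≤n+m (suc k₀) i) (≤-reflexive (sym (suc-injective k≡))))))
        (iterateSteps s 2T≤k₀ cover i (suc-injective k≡)) R κ)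

-- Growth of the weight over the phases

^-distribʳ-* : ∀ m n k → (m * n) ^ k ≡ m ^ k * n ^ k
^-distribʳ-* m n zero    = refl
^-distribʳ-* m n (suc k) = trans (cong (m * n *_) (^-distribʳ-* m n k)) (regroup m n (m ^ k) (n ^ k))
  where
  regroup : ∀ m n a b → m * n * (a * b) ≡ m * a * (n * b)
  regroup = solve-∀

n≤2^n : ∀ n → n ≤ 2 ^ n
n≤2^n zero    = z≤n
n≤2^n (suc n) = begin
  suc n          ≤⟨ +-mono-≤ (m^n>0 2 n) (n≤2^n n) ⟩
  2 ^ n + 2 ^ n  ≡⟨ cong (2 ^ n +_) (+-identityʳ (2 ^ n)) ⟨
  2 ^ suc n      ∎
  where open ≤-Reasoning

2^m<2^n⇒m<n : ∀ {m n} → 2 ^ m < 2 ^ n → m < n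
2^m<2^n⇒m<n {m} {n} 2^m<2^n with m <? n
... | yes m<n = m<n
... | no  m≮n = contradiction (<-≤-trans 2^m<2^n (^-monoʳ-≤ 2 (≮⇒≥ m≮n))) (<-irrefl refl)

[t+a]^j*u≤t^j*t : ∀ t a j u → j * a + u ≡ t → (t + a) ^ j * u ≤ t ^ j * t
[t+a]^j*u≤t^j*t t a zero    u ja+u≡t = ≤-reflexive (cong (_+ 0) ja+u≡t)
[t+a]^j*u≤t^j*t t a (suc j) u ja+u≡t = begin
  (t + a) * (t + a) ^ j * u
    ≡⟨ regroup₁ (t + a) ((t + a) ^ j) u ⟩
  (t + a) ^ j * ((t + a) * u)
    ≤⟨ *-monoʳ-≤ ((t + a) ^ j) [t+a]u≤t[u+a] ⟩
  (t + a) ^ j * (t * (u + a))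
    ≡⟨ regroup₂ ((t + a) ^ j) t (u + a) ⟩
  t * ((t + a) ^ j * (u + a))
    ≤⟨ *-monoʳ-≤ t ([t+a]^j*u≤t^j*t t a j (u + a) (trans (regroup₃ j a u) ja+u≡t)) ⟩
  t * (t ^ j * t)
    ≡⟨ *-assoc t (t ^ j) t ⟨
  t * t ^ j * t ∎
  where
  open ≤-Reasoning
  regroup₁ : ∀ x y u → x * y * u ≡ y * (x * u)
  regroup₁ = solve-∀
  regroup₂ : ∀ x t v → x * (t * v) ≡ t * (x * v)
  regroup₂ = solve-∀
  regroup₃ : ∀ j a u → j * a + (u + a) ≡ suc j * a + u
  regroup₃ = solve-∀
  [t+a]u≤t[u+a] : (t + a) * u ≤ t * (u + a)
  [t+a]u≤t[u+a] = begin
    (t + a) * u   ≡⟨ trans (*-distribʳ-+ u t a) (cong (t * u +_) (*-comm a u)) ⟩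
    t * u + u * a ≤⟨ +-monoʳ-≤ (t * u) (*-monoˡ-≤ a (subst (u ≤_) ja+u≡t (m≤n+m u _))) ⟩
    t * u + t * a ≡⟨ *-distribˡ-+ t u a ⟨
    t * (u + a)   ∎

[t+a]^j≤2*t^j : ∀ t a j .{{_ : NonZero t}} → 2 * (j * a) ≤ t → (t + a) ^ j ≤ 2 * t ^ j
[t+a]^j≤2*t^j t a j 2ja≤t = *-cancelʳ-≤ _ _ t (begin
  (t + a) ^ j * t        ≤⟨ *-monoʳ-≤ ((t + a) ^ j) t≤2u ⟩
  (t + a) ^ j * (2 * u)  ≡⟨ regroup ((t + a) ^ j) u ⟩
  2 * ((t + a) ^ j * u)  ≤⟨ *-monoʳ-≤ 2 ([t+a]^j*u≤t^j*t t a j u ja+u≡t) ⟩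
  2 * (t ^ j * t)        ≡⟨ *-assoc 2 (t ^ j) t ⟨
  2 * t ^ j * t          ∎)
  where
  open ≤-Reasoning
  u = t ∸ j * a
  ja+u≡t : j * a + u ≡ t
  ja+u≡t = m+[n∸m]≡n (≤-trans (m≤m+n (j * a) _) 2ja≤t)
  t≤2u : t ≤ 2 * u
  t≤2u = begin
    t                  ≡⟨ ja+u≡t ⟨
    j * a + u          ≤⟨ +-monoˡ-≤ u (+-cancelˡ-≤ (j * a) (j * a) u (subst (j * a + j * a ≤_) (sym ja+u≡t)
                                        (subst (_≤ t) (cong (j * a +_) (+-identityʳ (j * a))) 2ja≤t))) ⟩
    u + u              ≡⟨ cong (u +_) (+-identityʳ u) ⟨
    2 * u              ∎
  regroup : ∀ x u → x * (2 * u) ≡ 2 * (x * u)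
  regroup = solve-∀

[t+a]^i≤2^q*t^i : ∀ t a j .{{_ : NonZero t}} → 2 * (j * a) ≤ t →
  ∀ q i → i ≤ q * j → (t + a) ^ i ≤ 2 ^ q * t ^ i
[t+a]^i≤2^q*t^i t a j 2ja≤t zero    zero    _    = ≤-refl
[t+a]^i≤2^q*t^i t a j 2ja≤t (suc q) i       i≤qj with i ≤? j
... | yes i≤j = begin
  (t + a) ^ i      ≤⟨ [t+a]^j≤2*t^j t a i (≤-trans (*-monoʳ-≤ 2 (*-monoˡ-≤ a i≤j)) 2ja≤t) ⟩
  2 * t ^ i        ≤⟨ *-monoˡ-≤ (t ^ i) (*-monoʳ-≤ 2 (m^n>0 2 q)) ⟩
  2 ^ suc q * t ^ i ∎
  where open ≤-Reasoning
... | no  i≰j = begin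
  (t + a) ^ i
    ≡⟨ cong ((t + a) ^_) i≡j+i′ ⟩
  (t + a) ^ (j + i′)
    ≡⟨ ^-distribˡ-+-* (t + a) j i′ ⟩
  (t + a) ^ j * (t + a) ^ i′
    ≤⟨ *-mono-≤ ([t+a]^j≤2*t^j t a j 2ja≤t) ([t+a]^i≤2^q*t^i t a j 2ja≤t q i′ i′≤qj) ⟩
  2 * t ^ j * (2 ^ q * t ^ i′)
    ≡⟨ regroup (t ^ j) (2 ^ q) (t ^ i′) ⟩
  2 * 2 ^ q * (t ^ j * t ^ i′)
    ≡⟨ cong (2 * 2 ^ q *_) (^-distribˡ-+-* t j i′) ⟨
  2 * 2 ^ q * t ^ (j + i′)
    ≡⟨ cong (λ z → 2 * 2 ^ q * t ^ z) i≡j+i′ ⟨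
  2 ^ suc q * t ^ i ∎
  where
  open ≤-Reasoning
  i′ = i ∸ j
  i≡j+i′ : i ≡ j + i′
  i≡j+i′ = sym (m+[n∸m]≡n (<⇒≤ (≰⇒> i≰j)))
  i′≤qj : i′ ≤ q * j
  i′≤qj = +-cancelˡ-≤ j i′ (q * j) (subst (_≤ j + q * j) i≡j+i′ i≤qj)
  regroup : ∀ x y z → 2 * x * (y * z) ≡ 2 * y * (x * z)
  regroup = solve-∀

module PhaseGrowth (d₁ : ℕ) (1≤d₁ : 1 ≤ d₁) where

  d a : ℕ
  d = suc d₁
  a = 4 * d

  threshold : ℕ → ℕ
  threshold k = 2 * (2 ^ k) ^ d

  K : ℕ
  K = 2 ^ (2 + a) * 2 ^ d * suc a

  G : ℕ → ℕ
  G k = K * (2 ^ k) ^ d₁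

  G-double : ∀ k → G k + G k ≤ G (suc k)
  G-double k = begin
    K * P ^ d₁ + K * P ^ d₁          ≡⟨ cong (K * P ^ d₁ +_) (+-identityʳ _) ⟨
    2 * (K * P ^ d₁)                 ≤⟨ *-monoˡ-≤ (K * P ^ d₁) (^-monoʳ-≤ 2 1≤d₁) ⟩
    2 ^ d₁ * (K * P ^ d₁)            ≡⟨ regroup (2 ^ d₁) K (P ^ d₁) ⟩
    K * (2 ^ d₁ * P ^ d₁)            ≡⟨ cong (K *_) (^-distribʳ-* 2 P d₁) ⟨
    K * (2 * P) ^ d₁                 ∎
    where
    open ≤-Reasoning
    P = 2 ^ k
    regroup : ∀ x y z → x * (y * z) ≡ y * (x * z)
    regroup = solve-∀

  -- During phase k the step size is t = 2 ^ k and at most threshold (suc k) steps are taken.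
  phaseGrowth : ∀ k i → i ≤ threshold (suc k) → (2 ^ k + a) ^ i ≤ 2 ^ G k * (2 ^ k) ^ i
  phaseGrowth k i i≤ with k ≤? a
  ... | yes k≤a = begin
    (P + a) ^ i                  ≤⟨ ^-monoˡ-≤ i P+a≤2^[1+a]*P ⟩
    (2 ^ suc a * P) ^ i          ≡⟨ ^-distribʳ-* (2 ^ suc a) P i ⟩
    (2 ^ suc a) ^ i * P ^ i      ≡⟨ cong (_* P ^ i) (^-*-assoc 2 (suc a) i) ⟩
    2 ^ (suc a * i) * P ^ i      ≤⟨ *-monoˡ-≤ (P ^ i) (^-monoʳ-≤ 2 [1+a]*i≤G) ⟩
    2 ^ G k * P ^ i              ∎
    where
    open ≤-Reasoning
    P = 2 ^ k
    P≤2^a : P ≤ 2 ^ a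
    P≤2^a = ^-monoʳ-≤ 2 k≤a
    P+a≤2^[1+a]*P : P + a ≤ 2 ^ suc a * P
    P+a≤2^[1+a]*P = begin
      P + a
        ≤⟨ +-mono-≤ (m≤n*m P (2 ^ a) {{m^n≢0 2 a}}) (≤-trans (n≤2^n a) (m≤m*n (2 ^ a) P {{m^n≢0 2 k}})) ⟩
      2 ^ a * P + 2 ^ a * P
        ≡⟨ double (2 ^ a) P ⟩
      2 ^ suc a * P ∎
      where
      double : ∀ x P → x * P + x * P ≡ 2 * x * P
      double = solve-∀
    [1+a]*i≤G : suc a * i ≤ G k
    [1+a]*i≤G = begin
      suc a * i
        ≤⟨ *-monoʳ-≤ (suc a) i≤ ⟩
      suc a * (2 * (2 * P) ^ d)
        ≡⟨ cong (λ z → suc a * (2 * z)) (^-distribʳ-* 2 P d) ⟩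
      suc a * (2 * (2 ^ d * (P * P ^ d₁)))
        ≤⟨ *-monoʳ-≤ (suc a) (*-monoʳ-≤ 2 (*-monoʳ-≤ (2 ^ d) (*-monoˡ-≤ (P ^ d₁) P≤2^a))) ⟩
      suc a * (2 * (2 ^ d * (2 ^ a * P ^ d₁)))
        ≡⟨ regroup (suc a) (2 ^ d) (2 ^ a) (P ^ d₁) ⟩
      2 * 2 ^ a * 2 ^ d * suc a * P ^ d₁
        ≤⟨ *-monoˡ-≤ (P ^ d₁) (*-monoˡ-≤ (suc a) (*-monoˡ-≤ (2 ^ d) (m≤m+n (2 * 2 ^ a) _))) ⟩
      G k ∎
      where
      regroup : ∀ s x y z → s * (2 * (x * (y * z))) ≡ 2 * y * x * s * z
      regroup = solve-∀
  ... | no  k≰a = begin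
    (P + a) ^ i      ≤⟨ [t+a]^i≤2^q*t^i P a j {{m^n≢0 2 k}} 2ja≤P q i i≤qj ⟩
    2 ^ q * P ^ i    ≤⟨ *-monoˡ-≤ (P ^ i) (^-monoʳ-≤ 2 q≤G) ⟩
    2 ^ G k * P ^ i  ∎
    where
    open ≤-Reasoning
    P = 2 ^ k
    j = 2 ^ (k ∸ suc a)
    P≡2^[1+a]*j : P ≡ 2 ^ suc a * j
    P≡2^[1+a]*j = trans (cong (2 ^_) (sym (m+[n∸m]≡n (≰⇒> k≰a)))) (^-distribˡ-+-* 2 (suc a) (k ∸ suc a))
    2ja≤P : 2 * (j * a) ≤ P
    2ja≤P = begin
      2 * (j * a)      ≤⟨ *-monoʳ-≤ 2 (*-monoʳ-≤ j (n≤2^n a)) ⟩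
      2 * (j * 2 ^ a)  ≡⟨ regroup j (2 ^ a) ⟩
      2 ^ suc a * j    ≡⟨ P≡2^[1+a]*j ⟨
      P                ∎
      where
      regroup : ∀ j x → 2 * (j * x) ≡ 2 * x * j
      regroup = solve-∀
    q = 2 ^ (2 + a) * 2 ^ d * P ^ d₁
    i≤qj : i ≤ q * j
    i≤qj = begin
      i                                        ≤⟨ i≤ ⟩
      2 * (2 * P) ^ d                          ≡⟨ cong (2 *_) (^-distribʳ-* 2 P d) ⟩
      2 * (2 ^ d * (P * P ^ d₁))               ≡⟨ cong (λ z → 2 * (2 ^ d * (z * P ^ d₁))) P≡2^[1+a]*j ⟩
      2 * (2 ^ d * (2 ^ suc a * j * P ^ d₁))   ≡⟨ regroup (2 ^ d) (2 ^ a) j (P ^ d₁) ⟩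
      q * j                                    ∎
      where
      regroup : ∀ x y j z → 2 * (x * (2 * y * j * z)) ≡ 2 * (2 * y) * x * z * j
      regroup = solve-∀
    q≤G : q ≤ G k
    q≤G = begin
      2 ^ (2 + a) * 2 ^ d * P ^ d₁           ≤⟨ *-monoˡ-≤ (P ^ d₁) (m≤m*n (2 ^ (2 + a) * 2 ^ d) (suc a)) ⟩
      2 ^ (2 + a) * 2 ^ d * suc a * P ^ d₁   ∎

  C : ℕ
  C = (1 + 2 * d + 2 * K) ^ d * (2 ^ d₁) ^ d₁

  crossingBound : ∀ k N → (2 ^ k) ^ d ≤ 2 ^ d₁ * N → suc (2 * (k * d + G k)) ^ d ≤ C * N ^ d₁
  crossingBound k N P^d≤ = begin
    suc (2 * (k * d + K * Q)) ^ d      ≤⟨ ^-monoˡ-≤ d 1+2[kd+KQ]≤ ⟩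
    ((1 + 2 * d + 2 * K) * Q) ^ d      ≡⟨ ^-distribʳ-* (1 + 2 * d + 2 * K) Q d ⟩
    (1 + 2 * d + 2 * K) ^ d * Q ^ d    ≤⟨ *-monoʳ-≤ ((1 + 2 * d + 2 * K) ^ d) Q^d≤ ⟩
    (1 + 2 * d + 2 * K) ^ d * ((2 ^ d₁) ^ d₁ * N ^ d₁) ≡⟨ *-assoc ((1 + 2 * d + 2 * K) ^ d) _ _ ⟨
    C * N ^ d₁                         ∎
    where
    open ≤-Reasoning
    P = 2 ^ k
    Q = P ^ d₁
    1≤Q : 1 ≤ Q
    1≤Q = m^n>0 P {{m^n≢0 2 k}} d₁
    k≤Q : k ≤ Q
    k≤Q = ≤-trans (n≤2^n k) (≤-trans (≤-reflexive (sym (*-identityʳ P))) (^-monoʳ-≤ P {{m^n≢0 2 k}} 1≤d₁))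
    1+2[kd+KQ]≤ : suc (2 * (k * d + K * Q)) ≤ (1 + 2 * d + 2 * K) * Q
    1+2[kd+KQ]≤ = begin
      suc (2 * (k * d + K * Q)) ≤⟨ +-mono-≤ 1≤Q (*-monoʳ-≤ 2 (+-monoˡ-≤ (K * Q) (*-monoˡ-≤ d k≤Q))) ⟩
      Q + 2 * (Q * d + K * Q)   ≡⟨ regroup Q d K ⟩
      (1 + 2 * d + 2 * K) * Q   ∎
      where
      regroup : ∀ Q d K → Q + 2 * (Q * d + K * Q) ≡ (1 + 2 * d + 2 * K) * Q
      regroup = solve-∀
    Q^d≤ : Q ^ d ≤ (2 ^ d₁) ^ d₁ * N ^ d₁
    Q^d≤ = begin
      (P ^ d₁) ^ d                 ≡⟨ ^-*-assoc P d₁ d ⟩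
      P ^ (d₁ * d)                 ≡⟨ cong (P ^_) (*-comm d₁ d) ⟩
      P ^ (d * d₁)                 ≡⟨ ^-*-assoc P d d₁ ⟨
      (P ^ d) ^ d₁                 ≤⟨ ^-monoˡ-≤ d₁ P^d≤ ⟩
      (2 ^ d₁ * N) ^ d₁            ≡⟨ ^-distribʳ-* (2 ^ d₁) N d₁ ⟩
      (2 ^ d₁) ^ d₁ * N ^ d₁       ∎

  N<threshold[N] : ∀ N → N < threshold N
  N<threshold[N] N = begin-strict
    N                        ≤⟨ n≤2^n N ⟩
    2 ^ N                    ≤⟨ m≤m*n (2 ^ N) ((2 ^ N) ^ d₁) {{m^n≢0 (2 ^ N) d₁ {{m^n≢0 2 N}}}} ⟩
    (2 ^ N) ^ d              <⟨ m<m+n ((2 ^ N) ^ d) (m^n>0 (2 ^ N) {{m^n≢0 2 N}} d) ⟩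
    (2 ^ N) ^ d + (2 ^ N) ^ d ≡⟨ cong ((2 ^ N) ^ d +_) (+-identityʳ _) ⟨
    threshold N              ∎
    where open ≤-Reasoning

  phase : ∀ N k → 0 < N → N < threshold k → ∃ λ k′ → N < threshold k′ × (2 ^ k′) ^ d ≤ 2 ^ d₁ * N
  phase N zero    0<N N<Th = zero , N<Th , (begin
    (2 ^ 0) ^ d  ≡⟨ ^-zeroˡ d ⟩
    1            ≤⟨ *-mono-≤ (m^n>0 2 d₁) 0<N ⟩
    2 ^ d₁ * N   ∎)
    where open ≤-Reasoning
  phase N (suc k) 0<N N<Th′ with N <? threshold k
  ... | yes N<Th = phase N k 0<N N<Th
  ... | no  N≮Th = suc k , N<Th′ , (begin
    (2 * 2 ^ k) ^ d                 ≡⟨ ^-distribʳ-* 2 (2 ^ k) d ⟩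
    2 * 2 ^ d₁ * (2 ^ k) ^ d        ≡⟨ regroup (2 ^ d₁) ((2 ^ k) ^ d) ⟩
    2 ^ d₁ * threshold k            ≤⟨ *-monoʳ-≤ (2 ^ d₁) (≮⇒≥ N≮Th) ⟩
    2 ^ d₁ * N                      ∎)
    where
    open ≤-Reasoning
    regroup : ∀ x y → 2 * x * y ≡ x * (2 * y)
    regroup = solve-∀

module Phases {m n} (S : SignMatrix m n) {d₁} (1≤d₁ : 1 ≤ d₁)
              (vc : VCdim≤ S (suc d₁)) where

  open Welzl S vc
  open PhaseGrowth d₁ 1≤d₁

  0<threshold : ∀ k → 0 < threshold k
  0<threshold k = ≤-trans (m^n>0 (2 ^ k) {{m^n≢0 2 k}} d) (m≤m+n _ _)

  suc-pred-threshold : ∀ k → suc (pred (threshold k)) ≡ threshold k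
  suc-pred-threshold k = suc-pred (threshold k) {{>-nonZero (0<threshold k)}}

  -- Phase k: Welzl steps with t = 2 ^ k take N rows down to threshold k - 1 rows.
  runPhase : ∀ k {N} → threshold k ≤ N → N < threshold (suc k) →
    (∀ (R : Fin (pred (threshold k)) → Fin m) κ → CoveringPath R κ 1 (2 ^ G k)) →
    ∀ (R : Fin N → Fin m) κ → CoveringPath R κ 1 (2 ^ G (suc k))
  runPhase k {N} Th≤N N<Th′ cover R κ =
    CoveringPath-cancel (P ^ i) {{m^n≢0 P i {{m^n≢0 2 k}}}}
      (CoveringPath-mono (≤-reflexive (cong (λ t → t ^ i * 1) (sym 1+s≡P))) growth
        (iterateSteps s 2T≤1+k₀ cover i N≡i+k₀ R κ))
    where
    open ≤-Reasoning
    P = 2 ^ k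
    s = pred P
    1+s≡P : suc s ≡ P
    1+s≡P = suc-pred P {{m^n≢0 2 k}}
    k₀ = pred (threshold k)
    2T≤1+k₀ : 2 * suc s ^ d ≤ suc k₀
    2T≤1+k₀ = ≤-reflexive (trans (cong (λ t → 2 * t ^ d) 1+s≡P) (sym (suc-pred-threshold k)))
    i = N ∸ k₀
    N≡i+k₀ : N ≡ i + k₀
    N≡i+k₀ = sym (m∸n+n≡m (≤-trans (n≤1+n k₀) (subst (_≤ N) (sym (suc-pred-threshold k)) Th≤N)))
    i≤Th′ : i ≤ threshold (suc k)
    i≤Th′ = ≤-trans (m∸n≤m N k₀) (<⇒≤ N<Th′)
    growth : (suc s + 4 * d) ^ i * 2 ^ G k ≤ P ^ i * 2 ^ G (suc k)
    growth = begin
      (suc s + 4 * d) ^ i * 2 ^ G k    ≡⟨ cong (λ t → (t + 4 * d) ^ i * 2 ^ G k) 1+s≡P ⟩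
      (P + 4 * d) ^ i * 2 ^ G k        ≤⟨ *-monoˡ-≤ (2 ^ G k) (phaseGrowth k i i≤Th′) ⟩
      2 ^ G k * P ^ i * 2 ^ G k        ≡⟨ regroup (2 ^ G k) (P ^ i) ⟩
      P ^ i * (2 ^ G k * 2 ^ G k)      ≡⟨ cong (P ^ i *_) (^-distribˡ-+-* 2 (G k) (G k)) ⟨
      P ^ i * 2 ^ (G k + G k)          ≤⟨ *-monoʳ-≤ (P ^ i) (^-monoʳ-≤ 2 (G-double k)) ⟩
      P ^ i * 2 ^ G (suc k)            ∎
      where
      regroup : ∀ x y → x * y * x ≡ y * (x * x)
      regroup = solve-∀

  coveringPath : ∀ k {N} → N < threshold k → ∀ (R : Fin N → Fin m) κ → CoveringPath R κ 1 (2 ^ G k)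
  coveringPath zero {N} N<Th R κ =
    CoveringPath-mono ≤-refl (m^n>0 2 (G zero))
      (trivialPath R κ (≤-pred (subst (N <_) (cong (2 *_) (^-zeroˡ d)) N<Th)))
  coveringPath (suc k) {N} N<Th′ R κ with N <? threshold k
  ... | yes N<Th = CoveringPath-mono ≤-refl (^-monoʳ-≤ 2 (≤-trans (m≤n+m (G k) (G k)) (G-double k)))
                     (coveringPath k N<Th R κ)
  ... | no  N≮Th = runPhase k (≮⇒≥ N≮Th) N<Th′
                     (coveringPath k (≤-reflexive (suc-pred-threshold k))) R κ

  lowCrossingPath : ∀ k → m < threshold k → n < threshold k →
    Σ (List (Fin m)) λ L → (∀ i → i ∈ L) × (∀ j → crossings S j L ≤ 2 * (k * d + G k))
  lowCrossingPath k m<Th n<Th = path , covers , crossings≤K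
    where
    open CoveringPath (coveringPath k m<Th id (λ _ → 0))
    open ≤-Reasoning
    κ′≤ : ∀ j → κ′ j ≤ k * d + G k
    κ′≤ j = ≤-pred (2^m<2^n⇒m<n (begin-strict
      2 ^ κ′ j                        ≤⟨ f≤sum (λ j → 2 ^ κ′ j) j ⟩
      weight κ′                       ≡⟨ *-identityʳ (weight κ′) ⟨
      weight κ′ * 1                   ≤⟨ weight≤ ⟩
      weight (λ _ → 0) * 2 ^ G k      ≡⟨ cong (_* 2 ^ G k) (trans (sum-const n 1) (*-identityʳ n)) ⟩
      n * 2 ^ G k                     <⟨ *-monoˡ-< (2 ^ G k) {{m^n≢0 2 (G k)}} n<Th ⟩
      threshold k * 2 ^ G k           ≡⟨ cong (λ z → 2 * z * 2 ^ G k) (^-*-assoc 2 k d) ⟩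
      2 * 2 ^ (k * d) * 2 ^ G k       ≡⟨ *-assoc 2 (2 ^ (k * d)) (2 ^ G k) ⟩
      2 * (2 ^ (k * d) * 2 ^ G k)     ≡⟨ cong (2 *_) (^-distribˡ-+-* 2 (k * d) (G k)) ⟨
      2 ^ suc (k * d + G k)           ∎))
    crossings≤K : ∀ j → crossings S j path ≤ 2 * (k * d + G k)
    crossings≤K j = ≤-trans (m≤m+n _ (2 * 0)) (≤-trans (crossings≤ j) (*-monoʳ-≤ 2 (κ′≤ j)))

module _ {d₁ : ℕ} (1≤d₁ : 1 ≤ d₁) where

  open PhaseGrowth d₁ 1≤d₁

  signRank≤ : ∀ {N} (S : SignMatrix N N) → VCdim≤ S d → Σ ℕ λ r → r ^ d ≤ C * N ^ d₁ × SignRankAtMost S r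
  signRank≤ {zero}  S vc = 0 , z≤n , (λ ()) , (λ ()) , (λ ()) , (λ ()) , (λ ())
  signRank≤ {suc N} S vc with phase (suc N) (suc N) z<s (N<threshold[N] (suc N))
  ... | k , N<Th , [2^k]^d≤ with Phases.lowCrossingPath S 1≤d₁ vc k N<Th N<Th
  ... | L , covers , crossings≤ =
    suc (2 * (k * d + G k)) , crossingBound k (suc N) [2^k]^d≤ , signRank≤1+crossings S _ L covers crossings≤

theorem7 : (d : ℕ) → 2 ≤ d →
    Σ ℕ λ C → (N : ℕ) (S : SignMatrix N N) → VCdimIs S d →
    Σ ℕ λ r → (r ^ d ≤ C * N ^ (d ∸ 1)) × SignRankAtMost S r
theorem7 (suc d₁) (s≤s 1≤d₁) = PhaseGrowth.C d₁ 1≤d₁ , λ N S vc → signRank≤ 1≤d₁ S (proj₂ vc)
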